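{- Let $v\ge1$ and let $\mathbf s=(s_1,\dots,s_v)$ be a sequence of non-negative integers (not necessarily monotone). Let $\mathbf q$ be obtained from $\mathbf s$ by inserting an extra term $s_{v+1}$ (a non-negative integer, not necessarily the smallest). Then $g(\mathbf q)\ge g(\mathbf s)$. Moreover, if all elements of $\mathbf s$ are positive, then this inequality is strict.
   Context: For a sequence $\mathbf s$ of non-negative integers, the $\mathbf s$-deck has $s_i$ cards of Value $i$, with $c=s_1+\dots+s_v$ cards in total. In the $c$-round $\mathbf s$-game the deck is uniformly shuffled, and in each round the player names a value and then the top remaining card is turned; the player loses if some turned card has the value named in that round, and wins otherwise. The greedy strategy names, in every round, a value that is least frequent among the remaining cards. $g(\mathbf s)$ denotes the probability that the greedy strategy wins the $c$-round $\mathbf s$-game (the game where all cards are turned). -}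

module Defs where

open import Data.Nat using (ℕ; zero; suc; _+_; _<ᵇ_; _≡ᵇ_; _!)
open import Data.Nat.Properties using (_!≢0)
open import Data.Bool using (Bool; true; false; if_then_else_; not)
import Data.Bool
open import Data.List using (List; []; _∷_; length; filter; map; concatMap; replicate; _++_; upTo; take; drop)
open import Data.Integer using (+_)
open import Data.Rational using (ℚ; _/_)
open import Relation.Nullary.Decidable using (does)
open import Data.Nat using (_≟_)

-- Values are 0-indexed: s = (s_0,…,s_{v-1}) ; the s-deck has s_i cards of value i.
deckFrom : ℕ → List ℕ → List ℕ
deckFrom i []       = []
deckFrom i (n ∷ ns) = replicate n i ++ deckFrom (suc i) ns

deck : List ℕ → List ℕ
deck s = deckFrom 0 s

countV : ℕ → List ℕ → ℕ
countV i xs = length (filter (λ x → x ≟ i) xs)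

freqs : ℕ → List ℕ → List ℕ
freqs v rem = map (λ i → countV i rem) (upTo v)

-- index of the first minimal entry of a list (0 on the empty list)
argminAux : ℕ → ℕ → ℕ → List ℕ → ℕ
argminAux best bestVal i []       = best
argminAux best bestVal i (x ∷ xs) =
  if x <ᵇ bestVal then argminAux i x (suc i) xs else argminAux best bestVal (suc i) xs

argmin : List ℕ → ℕ
argmin []       = 0
argmin (x ∷ xs) = argminAux 0 x 1 xs

greedyGuess : ℕ → List ℕ → ℕ
greedyGuess v rem = argmin (freqs v rem)

-- play the greedy strategy against a fixed order of the deck; true = win
play : ℕ → List ℕ → Bool
play v []         = true
play v (x ∷ rest) = if greedyGuess v (x ∷ rest) ≡ᵇ x then false else play v rest

-- all orderings of a list of (labelled) cards, n! of them, duplicates counted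
insertions : {A : Set} → A → List A → List (List A)
insertions x []       = (x ∷ []) ∷ []
insertions x (y ∷ ys) = (x ∷ y ∷ ys) ∷ map (y ∷_) (insertions x ys)

perms : {A : Set} → List A → List (List A)
perms []       = [] ∷ []
perms (x ∷ xs) = concatMap (insertions x) (perms xs)

wins : List ℕ → ℕ
wins s = length (filter (λ o → play (length s) o Data.Bool.≟ true) (perms (deck s)))

g : List ℕ → ℚ
g s = (+ wins s) / (length (deck s) !) where instance _ = length (deck s) !≢0

insertAt : ℕ → ℕ → List ℕ → List ℕ
insertAt k x s = take k s ++ x ∷ drop k s

-- Let W(c) be the number of orderings of the deck with counts c that greedy wins, so that
-- g(c) = W(c) / |c|!. Conditioning on the first card (greedy survives it unless it has the
-- guessed value i, the first least frequent one) gives W(c) = Σ_{j ≠ i} c_j W(c − e_j).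
-- By induction on |c| this recursion yields g(c) ≤ g(c − e_p) for every present value p,
-- strictly when every value is present and there are at least two values.
-- The theorem then follows by induction on |c| + x, where x is the count of the inserted value.
-- If greedy's first guess on the extended deck is the new value, its recursion runs over the old
-- values only, and comparing it with the recursion for c takes g(c) ≤ g(c − e_p) on the extended
-- deck. Otherwise the guess is still i, and the recursion splits into the term of the new value,
-- which has one inserted card less, and the terms of the old values, which have one old card less.
module Submission where

open import Defs
open import Data.Bool using (Bool; true; false; if_then_else_; T)
import Data.Bool as Bool
open import Data.Empty using (⊥-elim)
import Data.Integer as ℤ
import Data.Integer.Properties as ℤ
open import Data.List using (List; []; _∷_; length; filter; map; concatMap; replicate; _++_; upTo; applyUpTo)
open import Data.List.Properties
  using (map-++; map-∘; map-cong; map-cong-local; map-applyUpTo; length-++; length-replicate; filter-++; filter-all; filter-none)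
open import Data.List.Relation.Binary.Permutation.Propositional using (_↭_; ↭-refl; ↭-prep; ↭-swap; ↭-trans)
open import Data.List.Relation.Binary.Permutation.Propositional.Properties using (↭-length; filter-↭)
open import Data.List.Relation.Unary.All using (All; []; _∷_)
import Data.List.Relation.Unary.All as All
import Data.List.Relation.Unary.All.Properties as All
open import Data.Nat
open import Data.Nat.ListAction using (sum)
open import Data.Nat.ListAction.Properties using (sum-++)
open import Data.Nat.Properties
open import Algebra.Properties.CommutativeSemigroup +-commutativeSemigroup
  using (interchange) renaming (x∙yz≈y∙xz to x+[y+z]≡y+[x+z])
open import Algebra.Properties.CommutativeSemigroup *-commutativeSemigroup
  using () renaming (x∙yz≈y∙xz to x*[y*z]≡y*[x*z]; xy∙z≈xz∙y to x*y*z≡x*z*y)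
open import Data.Nat.Tactic.RingSolver using (solve-∀)
open import Data.Product using (_×_; _,_; proj₁; proj₂; map₂; ∃)
import Data.Rational as ℚ
import Data.Rational.Properties as ℚ
open import Data.Rational.Unnormalised using (mkℚᵘ)
import Data.Rational.Unnormalised as ℚᵘ
import Data.Rational.Unnormalised.Properties as ℚᵘ
open import Data.Sum using (_⊎_; inj₁; inj₂)
open import Data.Unit using (tt)
open import Function using (_∘_; id)
open import Relation.Binary using (Tri; tri<; tri≈; tri>)
open import Relation.Binary.PropositionalEquality
open import Relation.Nullary using (Dec; yes; no)

private
  variable
    A B : Set

-- Sums over orderings

sumBy : (A → ℕ) → List A → ℕ
sumBy f xs = sum (map f xs)

sumBy-++ : ∀ (f : A → ℕ) xs ys → sumBy f (xs ++ ys) ≡ sumBy f xs + sumBy f ys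
sumBy-++ f xs ys = trans (cong sum (map-++ f xs ys)) (sum-++ (map f xs) (map f ys))

sumBy-map : ∀ (f : B → ℕ) (g : A → B) xs → sumBy f (map g xs) ≡ sumBy (f ∘ g) xs
sumBy-map f g xs = cong sum (sym (map-∘ xs))

sumBy-concatMap : ∀ (f : B → ℕ) (g : A → List B) xs →
  sumBy f (concatMap g xs) ≡ sumBy (sumBy f ∘ g) xs
sumBy-concatMap f g []       = refl
sumBy-concatMap f g (x ∷ xs) =
  trans (sumBy-++ f (g x) (concatMap g xs)) (cong (sumBy f (g x) +_) (sumBy-concatMap f g xs))

sumBy-+ : ∀ (f g : A → ℕ) xs → sumBy (λ x → f x + g x) xs ≡ sumBy f xs + sumBy g xs
sumBy-+ f g []       = refl
sumBy-+ f g (x ∷ xs) =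
  trans (cong (f x + g x +_) (sumBy-+ f g xs)) (interchange (f x) (g x) (sumBy f xs) (sumBy g xs))

sumBy-0 : ∀ (xs : List A) → sumBy (λ _ → 0) xs ≡ 0
sumBy-0 []       = refl
sumBy-0 (x ∷ xs) = sumBy-0 xs

picks : List A → List (A × List A)
picks []       = []
picks (x ∷ xs) = (x , xs) ∷ map (map₂ (x ∷_)) (picks xs)

private
  laterInsertions : (List A → ℕ) → A → List A → ℕ
  laterInsertions f x []      = 0
  laterInsertions f x (y ∷ p) = sumBy (f ∘ (y ∷_)) (insertions x p)

  sumBy-insertions : ∀ (f : List A → ℕ) x p →
    sumBy f (insertions x p) ≡ f (x ∷ p) + laterInsertions f x p
  sumBy-insertions f x []      = refl
  sumBy-insertions f x (y ∷ p) = cong (f (x ∷ y ∷ p) +_) (sumBy-map f (y ∷_) (insertions x p))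

-- An ordering of x ∷ xs starts with x or with some y of xs, followed by an ordering of the rest.
sumBy-perms : ∀ (f : List A → ℕ) x xs →
  sumBy f (perms (x ∷ xs)) ≡ sumBy (λ yr → sumBy (f ∘ (proj₁ yr ∷_)) (perms (proj₂ yr))) (picks (x ∷ xs))
sumBy-perms f x xs = begin
  sumBy f (concatMap (insertions x) (perms xs))
    ≡⟨ sumBy-concatMap f (insertions x) (perms xs) ⟩
  sumBy (sumBy f ∘ insertions x) (perms xs)
    ≡⟨ cong sum (map-cong (sumBy-insertions f x) (perms xs)) ⟩
  sumBy (λ p → f (x ∷ p) + laterInsertions f x p) (perms xs)
    ≡⟨ sumBy-+ (f ∘ (x ∷_)) (laterInsertions f x) (perms xs) ⟩
  sumBy (f ∘ (x ∷_)) (perms xs) + sumBy (laterInsertions f x) (perms xs)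
    ≡⟨ cong (sumBy (f ∘ (x ∷_)) (perms xs) +_) (trans (later xs) (sym (sumBy-map φ _ (picks xs)))) ⟩
  sumBy (f ∘ (x ∷_)) (perms xs) + sumBy φ (map (map₂ (x ∷_)) (picks xs)) ∎
  where
  open ≡-Reasoning
  φ : _ × List _ → ℕ
  φ yr = sumBy (f ∘ (proj₁ yr ∷_)) (perms (proj₂ yr))
  later : ∀ xs → sumBy (laterInsertions f x) (perms xs) ≡ sumBy (φ ∘ map₂ (x ∷_)) (picks xs)
  later []       = refl
  later (z ∷ zs) = trans (sumBy-perms (laterInsertions f x) z zs)
    (cong sum (map-cong (λ yr → sym (sumBy-concatMap (f ∘ (proj₁ yr ∷_)) (insertions x) (perms (proj₂ yr)))) (picks (z ∷ zs))))

insertions-↭ : ∀ (x : A) p → All (_↭ x ∷ p) (insertions x p)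
insertions-↭ x []      = ↭-refl ∷ []
insertions-↭ x (y ∷ p) =
  ↭-refl ∷ All.map⁺ (All.map (λ q↭ → ↭-trans (↭-prep y q↭) (↭-swap y x ↭-refl)) (insertions-↭ x p))

perms-↭ : ∀ (xs : List A) → All (_↭ xs) (perms xs)
perms-↭ []       = ↭-refl ∷ []
perms-↭ (x ∷ xs) = All.concat⁺ (All.map⁺ (All.map
  (λ {p} p↭ → All.map (λ q↭ → ↭-trans q↭ (↭-prep x p↭)) (insertions-↭ x p)) (perms-↭ xs)))

picks-↭ : ∀ (xs : List A) → All (λ yr → proj₁ yr ∷ proj₂ yr ↭ xs) (picks xs)
picks-↭ []       = []
picks-↭ (x ∷ xs) =
  ↭-refl ∷ All.map⁺ (All.map (λ yr↭ → ↭-trans (↭-swap _ x ↭-refl) (↭-prep x yr↭)) (picks-↭ xs))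

countV-↭ : ∀ i {xs ys} → xs ↭ ys → countV i xs ≡ countV i ys
countV-↭ i xs↭ys = ↭-length (filter-↭ (_≟ i) xs↭ys)

greedyGuess-↭ : ∀ v {xs ys} → xs ↭ ys → greedyGuess v xs ≡ greedyGuess v ys
greedyGuess-↭ v xs↭ys = cong argmin (map-cong (λ i → countV-↭ i xs↭ys) (upTo v))

countV-++ : ∀ i xs ys → countV i (xs ++ ys) ≡ countV i xs + countV i ys
countV-++ i xs ys = trans (cong length (filter-++ (_≟ i) xs ys)) (length-++ (filter (_≟ i) xs))

countV-replicate-≡ : ∀ a i → countV i (replicate a i) ≡ a
countV-replicate-≡ a i = trans (cong length (filter-all (_≟ i) (All.replicate⁺ a refl))) (length-replicate a)

countV-replicate-≢ : ∀ a {k i} → k ≢ i → countV i (replicate a k) ≡ 0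
countV-replicate-≢ a k≢i = cong length (filter-none (_≟ _) (All.replicate⁺ a k≢i))

-- c_j, which is 0 past the end of c.
at : List ℕ → ℕ → ℕ
at []      j       = 0
at (a ∷ c) zero    = a
at (a ∷ c) (suc j) = at c j

deckFrom-≥ : ∀ k s → All (k ≤_) (deckFrom k s)
deckFrom-≥ k []      = []
deckFrom-≥ k (a ∷ s) = All.++⁺ (All.replicate⁺ a ≤-refl) (All.map <⇒≤ (deckFrom-≥ (suc k) s))

countV-deckFrom : ∀ k s j → countV (k + j) (deckFrom k s) ≡ at s j
countV-deckFrom k []      j       = refl
countV-deckFrom k (a ∷ s) zero    = begin
  countV (k + 0) (replicate a k ++ deckFrom (suc k) s)
    ≡⟨ cong (λ i → countV i (replicate a k ++ deckFrom (suc k) s)) (+-identityʳ k) ⟩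
  countV k (replicate a k ++ deckFrom (suc k) s)
    ≡⟨ countV-++ k (replicate a k) (deckFrom (suc k) s) ⟩
  countV k (replicate a k) + countV k (deckFrom (suc k) s)
    ≡⟨ cong₂ _+_ (countV-replicate-≡ a k) (cong length (filter-none (_≟ k) (All.map >⇒≢ (deckFrom-≥ (suc k) s)))) ⟩
  a + 0
    ≡⟨ +-identityʳ a ⟩
  a ∎
  where open ≡-Reasoning
countV-deckFrom k (a ∷ s) (suc j) = begin
  countV (k + suc j) (replicate a k ++ deckFrom (suc k) s)
    ≡⟨ countV-++ (k + suc j) (replicate a k) (deckFrom (suc k) s) ⟩
  countV (k + suc j) (replicate a k) + countV (k + suc j) (deckFrom (suc k) s)
    ≡⟨ cong₂ _+_ (countV-replicate-≢ a (λ k≡ → m≢1+m+n k (trans k≡ (+-suc k j))))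
                 (cong (λ i → countV i (deckFrom (suc k) s)) (+-suc k j)) ⟩
  countV (suc k + j) (deckFrom (suc k) s)
    ≡⟨ countV-deckFrom (suc k) s j ⟩
  at s j ∎
  where open ≡-Reasoning

freqs-deck : ∀ s → freqs (length s) (deck s) ≡ s
freqs-deck s = trans (map-applyUpTo id (λ i → countV i (deck s)) (length s)) (applyUpTo-at s (countV-deckFrom 0 s))
  where
  applyUpTo-at : ∀ c {f} → (∀ i → f i ≡ at c i) → applyUpTo f (length c) ≡ c
  applyUpTo-at []      f≡ = refl
  applyUpTo-at (a ∷ c) f≡ = cong₂ _∷_ (f≡ 0) (applyUpTo-at c (f≡ ∘ suc))

greedyGuess-deck : ∀ s → greedyGuess (length s) (deck s) ≡ argmin s
greedyGuess-deck s = cong argmin (freqs-deck s)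

-- The recursion for wins

-- c − e_j, truncated: removing an absent value changes nothing.
removeCard : ℕ → List ℕ → List ℕ
removeCard j       []      = []
removeCard zero    (a ∷ c) = (a ∸ 1) ∷ c
removeCard (suc j) (a ∷ c) = a ∷ removeCard j c

-- removalSum κ F c = Σ_j κ j c_j * F (c − e_j).
removalSum : (ℕ → ℕ → ℕ) → (List ℕ → ℕ) → List ℕ → ℕ
removalSum κ F []      = 0
removalSum κ F (a ∷ c) = κ 0 a * F ((a ∸ 1) ∷ c) + removalSum (κ ∘ suc) (F ∘ (a ∷_)) c

removalSum-cong : ∀ κ κ′ F G c →
  (∀ j → j < length c → κ j (at c j) * F (removeCard j c) ≡ κ′ j (at c j) * G (removeCard j c)) →
  removalSum κ F c ≡ removalSum κ′ G c
removalSum-cong κ κ′ F G []      eq = refl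
removalSum-cong κ κ′ F G (a ∷ c) eq = cong₂ _+_ (eq 0 z<s)
  (removalSum-cong (κ ∘ suc) (κ′ ∘ suc) (F ∘ (a ∷_)) (G ∘ (a ∷_)) c (λ j j< → eq (suc j) (s<s j<)))

fromBool : Bool → ℕ
fromBool b = if b then 1 else 0

winsOf : ℕ → List ℕ → ℕ
winsOf v L = sumBy (fromBool ∘ play v) (perms L)

survives : ℕ → List ℕ → ℕ → ℕ
survives v L y = if greedyGuess v L ≡ᵇ y then 0 else 1

wins≡winsOf : ∀ s → wins s ≡ winsOf (length s) (deck s)
wins≡winsOf s = length-filter-true (play (length s)) (perms (deck s))
  where
  length-filter-true : ∀ (P : List ℕ → Bool) os → length (filter (λ o → P o Bool.≟ true) os) ≡ sumBy (fromBool ∘ P) os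
  length-filter-true P []       = refl
  length-filter-true P (o ∷ os) with P o
  ... | true  = cong suc (length-filter-true P os)
  ... | false = length-filter-true P os

winsOf-picks : ∀ v L → 0 < length L →
  winsOf v L ≡ sumBy (λ yr → survives v L (proj₁ yr) * winsOf v (proj₂ yr)) (picks L)
winsOf-picks v (x ∷ xs) _ = trans (sumBy-perms (fromBool ∘ play v) x xs)
  (cong sum (map-cong-local (All.map (λ {yr} → firstCard yr) (picks-↭ (x ∷ xs)))))
  where
  firstCard : ∀ yr → proj₁ yr ∷ proj₂ yr ↭ x ∷ xs →
    sumBy (fromBool ∘ play v ∘ (proj₁ yr ∷_)) (perms (proj₂ yr)) ≡ survives v (x ∷ xs) (proj₁ yr) * winsOf v (proj₂ yr)
  firstCard (y , r) yr↭ =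
    trans (cong sum (map-cong-local (All.map sameGuess (perms-↭ r)))) bySurvival
    where
    sameGuess : ∀ {p} → p ↭ r →
      fromBool (play v (y ∷ p)) ≡ fromBool (if greedyGuess v (x ∷ xs) ≡ᵇ y then false else play v p)
    sameGuess {p} p↭ = cong (λ i → fromBool (if i ≡ᵇ y then false else play v p))
      (greedyGuess-↭ v (↭-trans (↭-prep y p↭) yr↭))
    bySurvival : sumBy (λ p → fromBool (if greedyGuess v (x ∷ xs) ≡ᵇ y then false else play v p)) (perms r)
      ≡ survives v (x ∷ xs) y * winsOf v r
    bySurvival with greedyGuess v (x ∷ xs) ≡ᵇ y
    ... | true  = sumBy-0 (perms r)
    ... | false = sym (+-identityʳ (winsOf v r))

private
  pickSum : (ℕ → ℕ) → (List ℕ → ℕ) → List ℕ → ℕ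
  pickSum h F L = sumBy (λ yr → h (proj₁ yr) * F (proj₂ yr)) (picks L)

  pickSum-replicate-++ : ∀ h F k a R →
    pickSum h F (replicate a k ++ R) ≡ a * (h k * F (replicate (a ∸ 1) k ++ R)) + pickSum h (F ∘ (replicate a k ++_)) R
  pickSum-replicate-++ h F k zero    R = refl
  pickSum-replicate-++ h F k (suc a) R = begin
    h k * F (replicate a k ++ R) + sumBy _ (map (map₂ (k ∷_)) (picks (replicate a k ++ R)))
      ≡⟨ cong (h k * F (replicate a k ++ R) +_) (sumBy-map _ (map₂ (k ∷_)) (picks (replicate a k ++ R))) ⟩
    h k * F (replicate a k ++ R) + pickSum h (F ∘ (k ∷_)) (replicate a k ++ R)
      ≡⟨ cong (h k * F (replicate a k ++ R) +_) (pickSum-replicate-++ h (F ∘ (k ∷_)) k a R) ⟩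
    h k * F (replicate a k ++ R) + (a * (h k * F (k ∷ replicate (a ∸ 1) k ++ R)) + rest)
      ≡⟨ sym (+-assoc (h k * F (replicate a k ++ R)) _ rest) ⟩
    h k * F (replicate a k ++ R) + a * (h k * F (k ∷ replicate (a ∸ 1) k ++ R)) + rest
      ≡⟨ cong (_+ rest) (firstBlock a) ⟩
    suc a * (h k * F (replicate a k ++ R)) + rest ∎
    where
    open ≡-Reasoning
    rest = pickSum h (F ∘ (replicate (suc a) k ++_)) R
    firstBlock : ∀ a → h k * F (replicate a k ++ R) + a * (h k * F (k ∷ replicate (a ∸ 1) k ++ R))
      ≡ suc a * (h k * F (replicate a k ++ R))
    firstBlock zero    = refl
    firstBlock (suc a) = refl

  pickSum-deckFrom : ∀ h F k s →
    pickSum h F (deckFrom k s) ≡ removalSum (λ j a → a * h (k + j)) (F ∘ deckFrom k) s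
  pickSum-deckFrom h F k []      = refl
  pickSum-deckFrom h F k (a ∷ s) = trans (pickSum-replicate-++ h F k a (deckFrom (suc k) s)) (cong₂ _+_
    (trans (sym (*-assoc a (h k) _)) (cong (λ i → a * h i * F (deckFrom k ((a ∸ 1) ∷ s))) (sym (+-identityʳ k))))
    (trans (pickSum-deckFrom h (F ∘ (replicate a k ++_)) (suc k) s)
      (removalSum-cong _ _ _ _ s (λ j _ → cong (λ i → at s j * h i * F (deckFrom k (a ∷ removeCard j s))) (sym (+-suc k j))))))

length-deckFrom : ∀ k s → length (deckFrom k s) ≡ sum s
length-deckFrom k []      = refl
length-deckFrom k (a ∷ s) = trans (length-++ (replicate a k)) (cong₂ _+_ (length-replicate a) (length-deckFrom (suc k) s))

length-removeCard : ∀ j c → length (removeCard j c) ≡ length c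
length-removeCard j       []      = refl
length-removeCard zero    (a ∷ c) = refl
length-removeCard (suc j) (a ∷ c) = cong suc (length-removeCard j c)

-- The coefficient of c − e_j in the recursion when greedy guesses i.
except : ℕ → ℕ → ℕ → ℕ
except i j a = a * (if i ≡ᵇ j then 0 else 1)

wins-rec : ∀ s → 0 < sum s → wins s ≡ removalSum (except (argmin s)) wins s
wins-rec s 0<sum = begin
  wins s
    ≡⟨ wins≡winsOf s ⟩
  winsOf v (deck s)
    ≡⟨ winsOf-picks v (deck s) (subst (0 <_) (sym (length-deckFrom 0 s)) 0<sum) ⟩
  pickSum (survives v (deck s)) (winsOf v) (deck s)
    ≡⟨ pickSum-deckFrom (survives v (deck s)) (winsOf v) 0 s ⟩
  removalSum (λ j a → a * survives v (deck s) j) (winsOf v ∘ deck) s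
    ≡⟨ removalSum-cong _ _ _ _ s (λ j _ → cong₂ (λ i w → at s j * (if i ≡ᵇ j then 0 else 1) * w)
         (greedyGuess-deck s)
         (trans (cong (λ u → winsOf u (deck (removeCard j s))) (sym (length-removeCard j s))) (sym (wins≡winsOf (removeCard j s))))) ⟩
  removalSum (except (argmin s)) wins s ∎
  where
  open ≡-Reasoning
  v = length s

wins-empty : ∀ s → sum s ≡ 0 → wins s ≡ 1
wins-empty s sum≡0 = trans (wins≡winsOf s) (winsOf-[] (deck s) (trans (length-deckFrom 0 s) sum≡0))
  where
  winsOf-[] : ∀ L → length L ≡ 0 → winsOf (length s) L ≡ 1
  winsOf-[] [] _ = refl

at-removeCard-≡ : ∀ j c → at (removeCard j c) j ≡ at c j ∸ 1
at-removeCard-≡ j       []      = refl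
at-removeCard-≡ zero    (a ∷ c) = refl
at-removeCard-≡ (suc j) (a ∷ c) = at-removeCard-≡ j c

at-removeCard-≢ : ∀ {j k} c → j ≢ k → at (removeCard j c) k ≡ at c k
at-removeCard-≢ {j}     {k}     []      j≢k = refl
at-removeCard-≢ {zero}  {zero}  (a ∷ c) j≢k = ⊥-elim (j≢k refl)
at-removeCard-≢ {zero}  {suc k} (a ∷ c) j≢k = refl
at-removeCard-≢ {suc j} {zero}  (a ∷ c) j≢k = refl
at-removeCard-≢ {suc j} {suc k} (a ∷ c) j≢k = at-removeCard-≢ c (j≢k ∘ cong suc)

at-removeCard-≤ : ∀ j k c → at (removeCard j c) k ≤ at c k
at-removeCard-≤ j k c with j ≟ k
... | yes refl = subst (_≤ at c j) (sym (at-removeCard-≡ j c)) (m∸n≤m (at c j) 1)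
... | no  j≢k  = ≤-reflexive (at-removeCard-≢ c j≢k)

at-removeCard-suc : ∀ j c → 0 < at c j → at c j ≡ suc (at (removeCard j c) j)
at-removeCard-suc zero    (suc a ∷ c) _    = refl
at-removeCard-suc (suc j) (a ∷ c)     0<cⱼ = at-removeCard-suc j c 0<cⱼ

sum-removeCard : ∀ j c → 0 < at c j → sum c ≡ suc (sum (removeCard j c))
sum-removeCard zero    (suc a ∷ c) _   = refl
sum-removeCard (suc j) (a ∷ c)     0<cⱼ = trans (cong (a +_) (sum-removeCard j c 0<cⱼ)) (+-suc a _)

at<⇒<length : ∀ {k} j c → k < at c j → j < length c
at<⇒<length zero    (a ∷ c) _ = z<s
at<⇒<length (suc j) (a ∷ c) k<cⱼ = s<s (at<⇒<length j c k<cⱼ)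

at≤sum : ∀ c j → at c j ≤ sum c
at≤sum []      j       = z≤n
at≤sum (a ∷ c) zero    = m≤m+n a (sum c)
at≤sum (a ∷ c) (suc j) = ≤-trans (at≤sum c j) (m≤n+m (sum c) a)

removeCard-comm : ∀ i j c → removeCard i (removeCard j c) ≡ removeCard j (removeCard i c)
removeCard-comm i       j       []      = refl
removeCard-comm zero    zero    (a ∷ c) = refl
removeCard-comm zero    (suc j) (a ∷ c) = refl
removeCard-comm (suc i) zero    (a ∷ c) = refl
removeCard-comm (suc i) (suc j) (a ∷ c) = cong (a ∷_) (removeCard-comm i j c)

All-at : ∀ {P : ℕ → Set} {c j} → All P c → j < length c → P (at c j)
All-at {j = zero}  (p ∷ ps) _    = p
All-at {j = suc j} (p ∷ ps) j<   = All-at ps (s<s⁻¹ j<)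

removalSum-mono : ∀ κ κ′ F G c c′ → length c ≡ length c′ →
  (∀ j → j < length c → κ j (at c j) * F (removeCard j c) ≤ κ′ j (at c′ j) * G (removeCard j c′)) →
  removalSum κ F c ≤ removalSum κ′ G c′
removalSum-mono κ κ′ F G []      []       _   le = z≤n
removalSum-mono κ κ′ F G (a ∷ c) (b ∷ c′) len le = +-mono-≤ (le 0 z<s)
  (removalSum-mono (κ ∘ suc) (κ′ ∘ suc) (F ∘ (a ∷_)) (G ∘ (b ∷_)) c c′ (suc-injective len) (λ j j< → le (suc j) (s<s j<)))

removalSum-term≤ : ∀ κ F c j → j < length c → κ j (at c j) * F (removeCard j c) ≤ removalSum κ F c
removalSum-term≤ κ F (a ∷ c) zero    _  = m≤m+n _ _
removalSum-term≤ κ F (a ∷ c) (suc j) j< =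
  ≤-trans (removalSum-term≤ (κ ∘ suc) (F ∘ (a ∷_)) c j (s<s⁻¹ j<)) (m≤n+m _ _)

removalSum-const : ∀ K c → removalSum (λ _ → id) (λ _ → K) c ≡ sum c * K
removalSum-const K []      = refl
removalSum-const K (a ∷ c) = trans (cong (a * K +_) (removalSum-const K c)) (sym (*-distribʳ-+ K a (sum c)))

removalSum-*ˡ : ∀ K κ F c → K * removalSum κ F c ≡ removalSum κ ((K *_) ∘ F) c
removalSum-*ˡ K κ F []      = *-zeroʳ K
removalSum-*ˡ K κ F (a ∷ c) = trans (*-distribˡ-+ K (κ 0 a * F ((a ∸ 1) ∷ c)) _)
  (cong₂ _+_ (x*[y*z]≡y*[x*z] K (κ 0 a) _) (removalSum-*ˡ K (κ ∘ suc) (F ∘ (a ∷_)) c))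

removalSum-exchange : ∀ κ κ′ F c m → m < length c → (∀ j a → j ≢ m → κ j a ≡ κ′ j a) →
  removalSum κ F c + κ′ m (at c m) * F (removeCard m c) ≡ removalSum κ′ F c + κ m (at c m) * F (removeCard m c)
removalSum-exchange κ κ′ F (a ∷ c) zero _ agree =
  trans (cong (λ r → κ 0 a * X + r + κ′ 0 a * X) rest≡) (swapEnds (κ 0 a * X) _ (κ′ 0 a * X))
  where
  X = F ((a ∸ 1) ∷ c)
  rest≡ : removalSum (κ ∘ suc) (F ∘ (a ∷_)) c ≡ removalSum (κ′ ∘ suc) (F ∘ (a ∷_)) c
  rest≡ = removalSum-cong _ _ _ _ c (λ j _ → cong (_* F (a ∷ removeCard j c)) (agree (suc j) (at c j) (λ ())))
  swapEnds : ∀ x r y → x + r + y ≡ y + r + x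
  swapEnds = solve-∀
removalSum-exchange κ κ′ F (a ∷ c) (suc m) m< agree = begin
  H + R + Y   ≡⟨ +-assoc H R Y ⟩
  H + (R + Y) ≡⟨ cong (H +_) (removalSum-exchange (κ ∘ suc) (κ′ ∘ suc) (F ∘ (a ∷_)) c m (s<s⁻¹ m<)
                   (λ j b j≢m → agree (suc j) b (j≢m ∘ suc-injective))) ⟩
  H + (R′ + Z) ≡⟨ sym (+-assoc H R′ Z) ⟩
  H + R′ + Z   ≡⟨ cong (λ u → u * F ((a ∸ 1) ∷ c) + R′ + Z) (agree 0 a (λ ())) ⟩
  κ′ 0 a * F ((a ∸ 1) ∷ c) + R′ + Z ∎
  where
  open ≡-Reasoning
  H  = κ 0 a * F ((a ∸ 1) ∷ c)
  R  = removalSum (κ ∘ suc) (F ∘ (a ∷_)) c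
  R′ = removalSum (κ′ ∘ suc) (F ∘ (a ∷_)) c
  Y  = κ′ (suc m) (at c m) * F (a ∷ removeCard m c)
  Z  = κ (suc m) (at c m) * F (a ∷ removeCard m c)

except-≡ : ∀ i a → except i i a ≡ 0
except-≡ i a with i ≡ᵇ i in eq
... | true  = *-zeroʳ a
... | false = ⊥-elim (subst T eq (≡⇒≡ᵇ i i refl))

except-≢ : ∀ {i j} a → i ≢ j → except i j a ≡ a
except-≢ {i} {j} a i≢j with i ≡ᵇ j in eq
... | true  = ⊥-elim (i≢j (≡ᵇ⇒≡ i j (subst T (sym eq) tt)))
... | false = *-identityʳ a

except-≤ : ∀ i j a → except i j a ≤ a
except-≤ i j a with i ≟ j
... | yes refl = subst (_≤ a) (sym (except-≡ i a)) z≤n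
... | no  i≢j  = ≤-reflexive (except-≢ a i≢j)

removalSum-all : ∀ F c i → i < length c →
  removalSum (λ _ → id) F c ≡ removalSum (except i) F c + at c i * F (removeCard i c)
removalSum-all F c i i< = begin
  removalSum (λ _ → id) F c
    ≡⟨ +-identityʳ _ ⟨
  removalSum (λ _ → id) F c + 0
    ≡⟨ cong (λ u → removalSum (λ _ → id) F c + u * F (removeCard i c)) (except-≡ i (at c i)) ⟨
  removalSum (λ _ → id) F c + except i i (at c i) * F (removeCard i c)
    ≡⟨ removalSum-exchange (except i) (λ _ → id) F c i i< (λ j a j≢i → except-≢ a (j≢i ∘ sym)) ⟨
  removalSum (except i) F c + at c i * F (removeCard i c) ∎
  where open ≡-Reasoning

exceptBoth : ℕ → ℕ → ℕ → ℕ → ℕ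
exceptBoth i p j a = except i j (except p j a)

exceptBoth-comm : ∀ i p j a → exceptBoth i p j a ≡ exceptBoth p i j a
exceptBoth-comm i p j a = x*y*z≡x*z*y a _ _

Avoids : ℕ → (ℕ → ℕ → ℕ) → Set
Avoids p κ = ∀ j a → κ j a ≡ 0 ⊎ (j ≢ p × κ j a ≡ a)

except-avoids : ∀ p → Avoids p (except p)
except-avoids p j a with p ≟ j
... | yes refl = inj₁ (except-≡ p a)
... | no  p≢j  = inj₂ (p≢j ∘ sym , except-≢ a p≢j)

exceptBoth-avoids : ∀ i p → Avoids p (exceptBoth i p)
exceptBoth-avoids i p j a with except-avoids p j a
... | inj₁ drop = inj₁ (cong (except i j) drop)
... | inj₂ (j≢p , keep) with except-avoids i j a
...   | inj₁ drop′ = inj₁ (trans (cong (except i j) keep) drop′)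
...   | inj₂ (_ , keep′) = inj₂ (j≢p , trans (cong (except i j) keep) keep′)

record FirstMinimum (c : List ℕ) (i : ℕ) : Set where
  field
    index<   : i < length c
    minimal  : ∀ j → j < length c → at c i ≤ at c j
    earliest : ∀ j → j < i → at c i < at c j

firstMinimum-unique : ∀ {c i i′} → FirstMinimum c i → FirstMinimum c i′ → i ≡ i′
firstMinimum-unique {c} {i} {i′} m m′ with <-cmp i i′
... | tri≈ _ i≡i′ _ = i≡i′
... | tri< i<i′ _ _ = ⊥-elim (<-irrefl refl (<-≤-trans (earliest m′ i i<i′) (minimal m i′ (index< m′))))
  where open FirstMinimum
... | tri> _ _ i>i′ = ⊥-elim (<-irrefl refl (<-≤-trans (earliest m i′ i>i′) (minimal m′ i (index< m))))
  where open FirstMinimum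

private
  argminAux-firstMinimum : ∀ c best bestVal i xs →
    (∀ j → at c (i + j) ≡ at xs j) → length c ≡ i + length xs → best < i → at c best ≡ bestVal →
    (∀ j → j < i → bestVal ≤ at c j) → (∀ j → j < best → bestVal < at c j) →
    FirstMinimum c (argminAux best bestVal i xs)
  argminAux-firstMinimum c best bv i [] _ len b<i c≡bv low first = record
    { index<   = subst (best <_) (sym (trans len (+-identityʳ i))) b<i
    ; minimal  = λ j j< → subst (_≤ at c j) (sym c≡bv) (low j (subst (j <_) (trans len (+-identityʳ i)) j<))
    ; earliest = λ j j< → subst (_< at c j) (sym c≡bv) (first j j<)
    }
  argminAux-firstMinimum c best bv i (x ∷ xs) rest len b<i c≡bv low first with x <ᵇ bv in eq
  ... | true  = argminAux-firstMinimum c i x (suc i) xs rest′ (trans len (+-suc i (length xs))) (n<1+n i) cᵢ≡x low′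
                  (λ j j< → <-≤-trans x<bv (low j j<))
    where
    x<bv = <ᵇ⇒< x bv (subst T (sym eq) tt)
    cᵢ≡x : at c i ≡ x
    cᵢ≡x = trans (cong (at c) (sym (+-identityʳ i))) (rest 0)
    rest′ : ∀ j → at c (suc i + j) ≡ at xs j
    rest′ j = trans (cong (at c) (sym (+-suc i j))) (rest (suc j))
    low′ : ∀ j → j < suc i → x ≤ at c j
    low′ j j< with m≤n⇒m<n∨m≡n (s≤s⁻¹ j<)
    ... | inj₁ j<i  = <⇒≤ (<-≤-trans x<bv (low j j<i))
    ... | inj₂ refl = ≤-reflexive (sym cᵢ≡x)
  ... | false = argminAux-firstMinimum c best bv (suc i) xs rest′ (trans len (+-suc i (length xs))) (m<n⇒m<1+n b<i) c≡bv low′ first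
    where
    rest′ : ∀ j → at c (suc i + j) ≡ at xs j
    rest′ j = trans (cong (at c) (sym (+-suc i j))) (rest (suc j))
    low′ : ∀ j → j < suc i → bv ≤ at c j
    low′ j j< with m≤n⇒m<n∨m≡n (s≤s⁻¹ j<)
    ... | inj₁ j<i  = low j j<i
    ... | inj₂ refl = subst (bv ≤_) (sym (trans (cong (at c) (sym (+-identityʳ i))) (rest 0))) (≮⇒≥ (λ x<bv → subst T eq (<⇒<ᵇ x<bv)))

argmin-firstMinimum : ∀ c → 0 < length c → FirstMinimum c (argmin c)
argmin-firstMinimum (x ∷ xs) _ = argminAux-firstMinimum (x ∷ xs) 0 x 1 xs (λ _ → refl) refl z<s refl
  (λ { zero _ → ≤-refl ; (suc j) (s<s ()) }) (λ _ ())

argmin-removeCard : ∀ c p → 0 < length c → argmin (removeCard p c) ≡ argmin c ⊎ argmin (removeCard p c) ≡ p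
argmin-removeCard c p 0<len = byComparison (i′ ≟ p) (<-cmp i′ i)
  where
  open FirstMinimum
  open ≤-Reasoning
  c′ = removeCard p c
  i  = argmin c
  i′ = argmin c′
  m  = argmin-firstMinimum c 0<len
  m′ = argmin-firstMinimum c′ (subst (0 <_) (sym (length-removeCard p c)) 0<len)
  byComparison : Dec (i′ ≡ p) → Tri (i′ < i) (i′ ≡ i) (i′ > i) → i′ ≡ i ⊎ i′ ≡ p
  byComparison (yes i′≡p) _               = inj₂ i′≡p
  byComparison (no  _)    (tri≈ _ i′≡i _) = inj₁ i′≡i
  byComparison (no  i′≢p) (tri< i′<i _ _) = ⊥-elim (<-irrefl refl (<-≤-trans (earliest m i′ i′<i) (begin
    at c i′    ≡⟨ at-removeCard-≢ c (i′≢p ∘ sym) ⟨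
    at c′ i′   ≤⟨ minimal m′ i (subst (i <_) (sym (length-removeCard p c)) (index< m)) ⟩
    at c′ i    ≤⟨ at-removeCard-≤ p i c ⟩
    at c i     ∎)))
  byComparison (no  i′≢p) (tri> _ _ i′>i) = ⊥-elim (<-irrefl refl (<-≤-trans (earliest m′ i i′>i) (begin
    at c′ i    ≤⟨ at-removeCard-≤ p i c ⟩
    at c i     ≤⟨ minimal m i′ (subst (i′ <_) (length-removeCard p c) (index< m′)) ⟩
    at c i′    ≡⟨ at-removeCard-≢ c (i′≢p ∘ sym) ⟨
    at c′ i′   ∎)))

wins-rec-suc : ∀ {n} c → sum c ≡ suc n → wins c ≡ removalSum (except (argmin c)) wins c
wins-rec-suc c sum≡ = wins-rec c (subst (0 <_) (sym sum≡) z<s)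

sum-removeCard-pred : ∀ {n} j c → sum c ≡ suc n → 0 < at c j → sum (removeCard j c) ≡ n
sum-removeCard-pred j c sum≡ 0<cⱼ = suc-injective (trans (sym (sum-removeCard j c 0<cⱼ)) sum≡)

-- Termwise comparisons only need the hypothesis on terms that are present.
guarded-*-mono-≤ : ∀ {k a X Y} → k ≤ a → (0 < a → X ≤ Y) → k * X ≤ a * Y
guarded-*-mono-≤ {a = zero}  z≤n _   = z≤n
guarded-*-mono-≤ {a = suc a} k≤a X≤Y = *-mono-≤ k≤a (X≤Y z<s)

guarded-*-cong : ∀ {a X Y} → (0 < a → X ≡ Y) → a * X ≡ a * Y
guarded-*-cong {zero}  _   = refl
guarded-*-cong {suc a} X≡Y = cong (suc a *_) (X≡Y z<s)

wins≤! : ∀ c → wins c ≤ sum c !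
wins≤! c = go (sum c) c refl
  where
  go : ∀ n c → sum c ≡ n → wins c ≤ n !
  go zero    c sum≡ = ≤-reflexive (wins-empty c sum≡)
  go (suc n) c sum≡ = begin
    wins c                                  ≡⟨ wins-rec-suc c sum≡ ⟩
    removalSum (except (argmin c)) wins c   ≤⟨ removalSum-mono _ _ _ _ c c refl (λ j _ →
                                                 guarded-*-mono-≤ (except-≤ (argmin c) j (at c j))
                                                   (λ 0<cⱼ → go n (removeCard j c) (sum-removeCard-pred j c sum≡ 0<cⱼ))) ⟩
    removalSum (λ _ → id) (λ _ → n !) c     ≡⟨ removalSum-const (n !) c ⟩
    sum c * n !                             ≡⟨ cong (_* n !) sum≡ ⟩
    suc n ! ∎
    where open ≤-Reasoning

-- With a value absent, greedy names it every round and always wins.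
wins-absent : ∀ c j → j < length c → at c j ≡ 0 → wins c ≡ sum c !
wins-absent c j = go (sum c) c refl
  where
  go : ∀ n c → sum c ≡ n → j < length c → at c j ≡ 0 → wins c ≡ n !
  go zero    c sum≡ _  _    = wins-empty c sum≡
  go (suc n) c sum≡ j< cⱼ≡0 = begin
    wins c                                ≡⟨ wins-rec-suc c sum≡ ⟩
    removalSum (except i) wins c          ≡⟨ removalSum-cong _ _ _ _ c (λ k _ → term k) ⟩
    removalSum (λ _ → id) (λ _ → n !) c   ≡⟨ removalSum-const (n !) c ⟩
    sum c * n !                           ≡⟨ cong (_* n !) sum≡ ⟩
    suc n ! ∎
    where
    open ≡-Reasoning
    i = argmin c
    cᵢ≡0 : at c i ≡ 0
    cᵢ≡0 = n≤0⇒n≡0 (subst (at c i ≤_) cⱼ≡0 (FirstMinimum.minimal (argmin-firstMinimum c (≤-<-trans z≤n j<)) j j<))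
    noGuessedTerm : ∀ k → except i k (at c k) ≡ at c k
    noGuessedTerm k with i ≟ k
    ... | yes refl = trans (except-≡ i (at c i)) (sym cᵢ≡0)
    ... | no  i≢k  = except-≢ (at c k) i≢k
    stillAbsent : ∀ k → 0 < at c k → at (removeCard k c) j ≡ 0
    stillAbsent k 0<cₖ = trans (at-removeCard-≢ c (λ k≡j → <⇒≢ 0<cₖ (sym (trans (cong (at c) k≡j) cⱼ≡0)))) cⱼ≡0
    term : ∀ k → except i k (at c k) * wins (removeCard k c) ≡ at c k * n !
    term k = trans (cong (_* wins (removeCard k c)) (noGuessedTerm k)) (guarded-*-cong (λ 0<cₖ →
      go n (removeCard k c) (sum-removeCard-pred k c sum≡ 0<cₖ) (subst (j <_) (sym (length-removeCard k c)) j<) (stillAbsent k 0<cₖ)))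

sum-pos⇒at-pos : ∀ c → 0 < sum c → ∃ λ j → 0 < at c j
sum-pos⇒at-pos (zero  ∷ c) 0<sum with sum-pos⇒at-pos c 0<sum
... | j , 0<cⱼ = suc j , 0<cⱼ
sum-pos⇒at-pos (suc a ∷ c) _     = 0 , z<s

anotherIndex : ∀ i {n} → 2 ≤ n → ∃ λ k → k < n × i ≢ k
anotherIndex zero    2≤n = 1 , 2≤n , (λ ())
anotherIndex (suc _) 2≤n = 0 , <-≤-trans z<s 2≤n , (λ ())

unguessedCard : ∀ c → 2 ≤ length c → 0 < sum c → ∃ λ k → k < length c × argmin c ≢ k × 0 < at c k
unguessedCard c 2≤len 0<sum with sum-pos⇒at-pos c 0<sum
... | j , 0<cⱼ with argmin c ≟ j
...   | no  i≢j  = j , at<⇒<length j c 0<cⱼ , i≢j , 0<cⱼ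
...   | yes refl with anotherIndex (argmin c) 2≤len
...     | k , k< , i≢k =
  k , k< , i≢k , <-≤-trans 0<cⱼ (FirstMinimum.minimal (argmin-firstMinimum c (<-≤-trans z<s 2≤len)) k k<)

wins-pos : ∀ c → 2 ≤ length c → 0 < wins c
wins-pos c = go (sum c) c refl
  where
  go : ∀ n c → sum c ≡ n → 2 ≤ length c → 0 < wins c
  go zero    c sum≡ _     = subst (0 <_) (sym (wins-empty c sum≡)) z<s
  go (suc n) c sum≡ 2≤len = survivingTerm (unguessedCard c 2≤len (subst (0 <_) (sym sum≡) z<s))
    where
    i = argmin c
    survivingTerm : (∃ λ k → k < length c × i ≢ k × 0 < at c k) → 0 < wins c
    survivingTerm (k , k< , i≢k , 0<cₖ) = begin-strict
      0                                              <⟨ *-mono-< 0<cₖ (go n (removeCard k c) (sum-removeCard-pred k c sum≡ 0<cₖ)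
                                                          (subst (2 ≤_) (sym (length-removeCard k c)) 2≤len)) ⟩
      at c k * wins (removeCard k c)                 ≡⟨ cong (_* wins (removeCard k c)) (except-≢ (at c k) i≢k) ⟨
      except i k (at c k) * wins (removeCard k c)    ≤⟨ removalSum-term≤ (except i) wins c k k< ⟩
      removalSum (except i) wins c                   ≡⟨ wins-rec-suc c sum≡ ⟨
      wins c ∎
      where open ≤-Reasoning

-- The term of the guessed value, which the recursion drops, is then nonzero.
wins<! : ∀ c → All (0 <_) c → 0 < length c → wins c < sum c !
wins<! c allPos 0<len with sum c in sum≡
... | zero  = ⊥-elim (<⇒≢ (<-≤-trans (All-at allPos (index< m)) (at≤sum c i)) (sym sum≡))
  where
  open FirstMinimum
  i = argmin c
  m = argmin-firstMinimum c 0<len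
... | suc n = begin-strict
  wins c                                                ≡⟨ wins-rec-suc c sum≡ ⟩
  removalSum (except i) wins c                          ≤⟨ removalSum-mono _ _ _ _ c c refl (λ j _ → guarded-*-mono-≤ ≤-refl (λ 0<κ →
                                                             subst (λ m → wins (removeCard j c) ≤ m !)
                                                               (sum-removeCard-pred j c sum≡ (<-≤-trans 0<κ (except-≤ i j (at c j))))
                                                               (wins≤! (removeCard j c)))) ⟩
  removalSum (except i) (λ _ → n !) c                   <⟨ m<m+n _ (*-mono-≤ (All-at allPos (index< m)) (1≤n! n)) ⟩
  removalSum (except i) (λ _ → n !) c + at c i * n !    ≡⟨ removalSum-all (λ _ → n !) c i (index< m) ⟨
  removalSum (λ _ → id) (λ _ → n !) c                   ≡⟨ removalSum-const (n !) c ⟩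
  sum c * n !                                           ≡⟨ cong (_* n !) sum≡ ⟩
  suc n ! ∎
  where
  open ≤-Reasoning
  open FirstMinimum
  i = argmin c
  m = argmin-firstMinimum c 0<len

-- Removing a card

removalSum-except : ∀ {i p} F c → i ≢ p → p < length c →
  removalSum (except i) F c ≡ removalSum (exceptBoth i p) F c + at c p * F (removeCard p c)
removalSum-except {i} {p} F c i≢p p< = begin
  removalSum (except i) F c
    ≡⟨ +-identityʳ _ ⟨
  removalSum (except i) F c + 0
    ≡⟨ cong (λ u → removalSum (except i) F c + except i p u * F (removeCard p c)) (except-≡ p (at c p)) ⟨
  removalSum (except i) F c + exceptBoth i p p (at c p) * F (removeCard p c)
    ≡⟨ removalSum-exchange (exceptBoth i p) (except i) F c p p< (λ j a j≢p → cong (except i j) (except-≢ a (j≢p ∘ sym))) ⟨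
  removalSum (exceptBoth i p) F c + except i p (at c p) * F (removeCard p c)
    ≡⟨ cong (λ u → removalSum (exceptBoth i p) F c + u * F (removeCard p c)) (except-≢ (at c p) i≢p) ⟩
  removalSum (exceptBoth i p) F c + at c p * F (removeCard p c) ∎
  where open ≡-Reasoning

scaled-wins-split : ∀ K {m} d q → sum d ≡ suc m → argmin d ≢ q → q < length d →
  K * wins d ≡ removalSum (exceptBoth (argmin d) q) ((K *_) ∘ wins) d + at d q * (K * wins (removeCard q d))
scaled-wins-split K d q sum≡ g≢q q< = begin
  K * wins d
    ≡⟨ cong (K *_) (trans (wins-rec-suc d sum≡) (removalSum-except wins d g≢q q<)) ⟩
  K * (removalSum (exceptBoth guess q) wins d + at d q * wins (removeCard q d))
    ≡⟨ *-distribˡ-+ K _ _ ⟩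
  K * removalSum (exceptBoth guess q) wins d + K * (at d q * wins (removeCard q d))
    ≡⟨ cong₂ _+_ (removalSum-*ˡ K (exceptBoth guess q) wins d) (x*[y*z]≡y*[x*z] K (at d q) _) ⟩
  removalSum (exceptBoth guess q) ((K *_) ∘ wins) d + at d q * (K * wins (removeCard q d)) ∎
  where
  open ≡-Reasoning
  guess = argmin d

-- g(c) ≤ g(c − e_p), with denominators cleared.
RemovalBound : ℕ → Set
RemovalBound n = ∀ c p → sum c ≡ n → 0 < at c p → wins c ≤ n * wins (removeCard p c)

removalSum-avoiding-≤ : ∀ {n} → RemovalBound n → ∀ κ c p → Avoids p κ → sum c ≡ suc n → 0 < at c p →
  removalSum κ wins c ≤ removalSum κ ((n *_) ∘ wins) (removeCard p c)
removalSum-avoiding-≤ {n} bound κ c p avoids sum≡ 0<cₚ =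
  removalSum-mono κ κ wins _ c c′ (sym (length-removeCard p c)) term
  where
  c′ = removeCard p c
  term : ∀ j → j < length c → κ j (at c j) * wins (removeCard j c) ≤ κ j (at c′ j) * (n * wins (removeCard j c′))
  term j _ with avoids j (at c j)
  ... | inj₁ drop = subst (λ u → u * wins (removeCard j c) ≤ κ j (at c′ j) * (n * wins (removeCard j c′))) (sym drop) z≤n
  ... | inj₂ (j≢p , keep) = subst (λ u → _ ≤ κ j u * (n * wins (removeCard j c′))) (sym (at-removeCard-≢ c (j≢p ∘ sym)))
    (guarded-*-mono-≤ ≤-refl (λ 0<κ → let 0<cⱼ = subst (0 <_) keep 0<κ in
      subst (λ d → wins (removeCard j c) ≤ n * wins d) (removeCard-comm p j c)
        (bound (removeCard j c) p (sum-removeCard-pred j c sum≡ 0<cⱼ) (subst (0 <_) (sym (at-removeCard-≢ c j≢p)) 0<cₚ))))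

scaled-wins-split-≤ : ∀ {m} → RemovalBound (suc m) → ∀ d q k → sum d ≡ suc m → argmin d ≢ q → q < length d → k ≤ at d q →
  removalSum (exceptBoth (argmin d) q) ((suc m *_) ∘ wins) d + k * wins d ≤ suc m * wins d
scaled-wins-split-≤ {m} bound d q k sum≡ g≢q q< k≤ = begin
  R + k * wins d                                    ≤⟨ +-monoʳ-≤ R (guarded-*-mono-≤ k≤ (bound d q sum≡)) ⟩
  R + at d q * (suc m * wins (removeCard q d))      ≡⟨ scaled-wins-split (suc m) d q sum≡ g≢q q< ⟨
  suc m * wins d ∎
  where
  open ≤-Reasoning
  R = removalSum (exceptBoth (argmin d) q) ((suc m *_) ∘ wins) d

removalSum-exceptBoth-comm : ∀ i p F d → removalSum (exceptBoth i p) F d ≡ removalSum (exceptBoth p i) F d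
removalSum-exceptBoth-comm i p F d =
  removalSum-cong _ _ _ _ d (λ j _ → cong (_* F (removeCard j d)) (exceptBoth-comm i p j (at d j)))

argmin-removeCard-argmin : ∀ c → 0 < length c → argmin (removeCard (argmin c) c) ≡ argmin c
argmin-removeCard-argmin c 0<len with argmin-removeCard c (argmin c) 0<len
... | inj₁ i′≡i = i′≡i
... | inj₂ i′≡i = i′≡i

wins-removeCard-guess : ∀ {m} → RemovalBound (suc m) → ∀ c → sum c ≡ suc (suc m) → 0 < at c (argmin c) →
  wins c ≤ suc m * wins (removeCard (argmin c) c)
wins-removeCard-guess {m} bound c sum≡ 0<cᵢ = begin
  wins c                                    ≡⟨ wins-rec-suc c sum≡ ⟩
  removalSum (except i) wins c              ≤⟨ removalSum-avoiding-≤ bound (except i) c i (except-avoids i) sum≡ 0<cᵢ ⟩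
  removalSum (except i) ((n *_) ∘ wins) c′  ≡⟨ removalSum-*ˡ n (except i) wins c′ ⟨
  n * removalSum (except i) wins c′         ≡⟨ cong (n *_) (trans (wins-rec-suc c′ (sum-removeCard-pred i c sum≡ 0<cᵢ))
                                                 (cong (λ j → removalSum (except j) wins c′) (argmin-removeCard-argmin c 0<len))) ⟨
  n * wins c′ ∎
  where
  open ≤-Reasoning
  n = suc m
  i = argmin c
  c′ = removeCard i c
  0<len = ≤-<-trans z≤n (at<⇒<length i c 0<cᵢ)

wins-removeCard-other : ∀ {n} → RemovalBound n → ∀ c p → sum c ≡ suc n → 0 < at c p → argmin c ≢ p →
  let c′ = removeCard p c in
  wins c ≤ wins c′ + (removalSum (exceptBoth (argmin c) p) ((n *_) ∘ wins) c′ + at c′ p * wins c′)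
wins-removeCard-other {n} bound c p sum≡ 0<cₚ i≢p = begin
  wins c                                          ≡⟨ wins-rec-suc c sum≡ ⟩
  removalSum (except i) wins c                    ≡⟨ removalSum-except wins c i≢p (at<⇒<length p c 0<cₚ) ⟩
  removalSum (exceptBoth i p) wins c + at c p * wins c′
                                                  ≤⟨ +-monoˡ-≤ _ (removalSum-avoiding-≤ bound (exceptBoth i p) c p
                                                                     (exceptBoth-avoids i p) sum≡ 0<cₚ) ⟩
  R′ + at c p * wins c′                           ≡⟨ cong (λ a → R′ + a * wins c′) (at-removeCard-suc p c 0<cₚ) ⟩
  R′ + (wins c′ + at c′ p * wins c′)              ≡⟨ x+[y+z]≡y+[x+z] R′ (wins c′) (at c′ p * wins c′) ⟩
  wins c′ + (R′ + at c′ p * wins c′) ∎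
  where
  open ≤-Reasoning
  i = argmin c
  c′ = removeCard p c
  R′ = removalSum (exceptBoth i p) ((n *_) ∘ wins) c′

remainingTerms-≤ : ∀ {m} → RemovalBound (suc m) → ∀ d i p → sum d ≡ suc m → i ≢ p → i < length d → p < length d →
  argmin d ≡ i ⊎ argmin d ≡ p →
  removalSum (exceptBoth i p) ((suc m *_) ∘ wins) d + at d p * wins d ≤ suc m * wins d
remainingTerms-≤ bound d i p sum≡ i≢p i< p< (inj₁ refl) = scaled-wins-split-≤ bound d p (at d p) sum≡ i≢p p< ≤-refl
remainingTerms-≤ bound d i p sum≡ i≢p i< p< (inj₂ refl) =
  subst (λ R → R + at d p * wins d ≤ _) (removalSum-exceptBoth-comm p i _ d)
    (scaled-wins-split-≤ bound d i (at d p) sum≡ (i≢p ∘ sym) i< (FirstMinimum.minimal (argmin-firstMinimum d (≤-<-trans z≤n i<)) i i<))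

removalBound-step : ∀ {m} → RemovalBound (suc m) → RemovalBound (suc (suc m))
removalBound-step {m} bound c p sum≡ 0<cₚ with argmin c ≟ p
... | yes refl = ≤-trans (wins-removeCard-guess bound c sum≡ 0<cₚ) (m≤n+m _ (wins (removeCard p c)))
... | no  i≢p  = ≤-trans (wins-removeCard-other bound c p sum≡ 0<cₚ i≢p) (+-monoʳ-≤ (wins c′)
    (remainingTerms-≤ bound c′ (argmin c) p (sum-removeCard-pred p c sum≡ 0<cₚ) i≢p (length′ (index< (argmin-firstMinimum c 0<len)))
      (length′ (at<⇒<length p c 0<cₚ)) (argmin-removeCard c p 0<len)))
  where
  open FirstMinimum
  c′ = removeCard p c
  0<len = ≤-<-trans z≤n (at<⇒<length p c 0<cₚ)
  length′ : ∀ {j} → j < length c → j < length c′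
  length′ = subst (_ <_) (sym (length-removeCard p c))

removalBound : ∀ n → RemovalBound n
removalBound zero c p sum≡ 0<cₚ = ⊥-elim (<⇒≢ (<-≤-trans 0<cₚ (at≤sum c p)) (sym sum≡))
removalBound (suc zero) c p sum≡ 0<cₚ = begin
  wins c                           ≤⟨ wins≤! c ⟩
  sum c !                          ≡⟨ cong _! sum≡ ⟩
  1                                ≡⟨ cong (1 *_) (wins-empty (removeCard p c) (sum-removeCard-pred p c sum≡ 0<cₚ)) ⟨
  1 * wins (removeCard p c) ∎
  where open ≤-Reasoning
removalBound (suc (suc m)) = removalBound-step (removalBound (suc m))

StrictRemovalBound : ℕ → Set
StrictRemovalBound n = ∀ c p → sum c ≡ n → All (0 <_) c → 2 ≤ length c → p < length c →
  wins c < n * wins (removeCard p c)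

All-removeCard : ∀ p c → All (0 <_) c → 2 ≤ at c p → All (0 <_) (removeCard p c)
All-removeCard zero    (a ∷ c) (_ ∷ allPos)   2≤a = ∸-monoˡ-≤ 1 2≤a ∷ allPos
All-removeCard (suc p) (a ∷ c) (0<a ∷ allPos) 2≤cₚ = 0<a ∷ All-removeCard p c allPos 2≤cₚ

scaled-wins-split-< : ∀ {m} → StrictRemovalBound (suc m) → ∀ d q k → sum d ≡ suc m → All (0 <_) d → 2 ≤ length d →
  argmin d ≢ q → q < length d → 0 < k → k ≤ at d q →
  removalSum (exceptBoth (argmin d) q) ((suc m *_) ∘ wins) d + k * wins d < suc m * wins d
scaled-wins-split-< {m} bound d q k sum≡ allPos 2≤len g≢q q< 0<k k≤ = begin-strict
  R + k * wins d                                    ≤⟨ +-monoʳ-≤ R (*-monoˡ-≤ (wins d) k≤) ⟩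
  R + at d q * wins d                               <⟨ +-monoʳ-< R (*-monoʳ-< (at d q) {{>-nonZero (<-≤-trans 0<k k≤)}}
                                                         (bound d q sum≡ allPos 2≤len q<)) ⟩
  R + at d q * (suc m * wins (removeCard q d))      ≡⟨ scaled-wins-split (suc m) d q sum≡ g≢q q< ⟨
  suc m * wins d ∎
  where
  open ≤-Reasoning
  R = removalSum (exceptBoth (argmin d) q) ((suc m *_) ∘ wins) d

remainingTerms-< : ∀ {m} → StrictRemovalBound (suc m) → ∀ d i p → sum d ≡ suc m → All (0 <_) d → 2 ≤ length d →
  i ≢ p → i < length d → p < length d → argmin d ≡ i ⊎ argmin d ≡ p →
  removalSum (exceptBoth i p) ((suc m *_) ∘ wins) d + at d p * wins d < suc m * wins d
remainingTerms-< bound d i p sum≡ allPos 2≤len i≢p i< p< (inj₁ refl) =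
  scaled-wins-split-< bound d p (at d p) sum≡ allPos 2≤len i≢p p< (All-at allPos p<) ≤-refl
remainingTerms-< bound d i p sum≡ allPos 2≤len i≢p i< p< (inj₂ refl) =
  subst (λ R → R + at d p * wins d < _) (removalSum-exceptBoth-comm p i _ d)
    (scaled-wins-split-< bound d i (at d p) sum≡ allPos 2≤len (i≢p ∘ sym) i< (All-at allPos p<)
      (FirstMinimum.minimal (argmin-firstMinimum d (≤-<-trans z≤n i<)) i i<))

strictRemovalBound-step : ∀ {m} → StrictRemovalBound (suc m) → StrictRemovalBound (suc (suc m))
strictRemovalBound-step {m} bound c p sum≡ allPos 2≤len p< with argmin c ≟ p
... | yes refl = <-≤-trans (m<n+m _ (wins-pos c′ (length′ 2≤len)))
                   (+-monoʳ-≤ (wins c′) (wins-removeCard-guess (removalBound (suc m)) c sum≡ 0<cₚ))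
  where
  c′ = removeCard p c
  0<cₚ = All-at allPos p<
  length′ : ∀ {j} → j ≤ length c → j ≤ length c′
  length′ = subst (_ ≤_) (sym (length-removeCard p c))
... | no  i≢p with at c p in cₚ≡
...   | zero = ⊥-elim (<⇒≢ (All-at allPos p<) (sym cₚ≡))
...   | suc zero = begin-strict
  -- p is absent from c′, so greedy wins every ordering of c′.
  wins c                       <⟨ wins<! c allPos (<-≤-trans z<s 2≤len) ⟩
  sum c !                      ≡⟨ cong _! sum≡ ⟩
  suc n * n !                  ≡⟨ cong (λ m → suc n * m !) (sum-removeCard-pred p c sum≡ 0<cₚ) ⟨
  suc n * sum c′ !             ≡⟨ cong (suc n *_) (wins-absent c′ p (length′ p<) (trans (at-removeCard-≡ p c) (cong (_∸ 1) cₚ≡))) ⟨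
  suc n * wins c′ ∎
  where
  open ≤-Reasoning
  n = suc m
  c′ = removeCard p c
  0<cₚ = subst (0 <_) (sym cₚ≡) z<s
  length′ : ∀ {j} → j < length c → j < length c′
  length′ = subst (_ <_) (sym (length-removeCard p c))
...   | suc (suc a) = ≤-<-trans (wins-removeCard-other (removalBound (suc m)) c p sum≡ 0<cₚ i≢p) (+-monoʳ-< (wins c′)
    (remainingTerms-< bound c′ (argmin c) p (sum-removeCard-pred p c sum≡ 0<cₚ) (All-removeCard p c allPos 2≤cₚ)
      (subst (2 ≤_) (sym (length-removeCard p c)) 2≤len) i≢p (length′ (index< (argmin-firstMinimum c 0<len)))
      (length′ p<) (argmin-removeCard c p 0<len)))
  where
  open FirstMinimum
  c′ = removeCard p c
  0<len = <-≤-trans z<s 2≤len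
  2≤cₚ = subst (2 ≤_) (sym cₚ≡) (s≤s (s≤s z≤n))
  0<cₚ = <-≤-trans z<s 2≤cₚ
  length′ : ∀ {j} → j < length c → j < length c′
  length′ = subst (_ <_) (sym (length-removeCard p c))

strictRemovalBound : ∀ n → StrictRemovalBound n
strictRemovalBound zero c p sum≡ allPos _ p< = ⊥-elim (<⇒≢ (<-≤-trans (All-at allPos p<) (at≤sum c p)) (sym sum≡))
strictRemovalBound (suc zero) c p sum≡ allPos 2≤len p< with anotherIndex p 2≤len
... | q , q< , p≢q = ⊥-elim (<⇒≢ (begin-strict
  0                        <⟨ All-at allPos q< ⟩
  at c q                   ≡⟨ at-removeCard-≢ c p≢q ⟨
  at (removeCard p c) q    ≤⟨ at≤sum (removeCard p c) q ⟩
  sum (removeCard p c)     ≡⟨ sum-removeCard-pred p c sum≡ (All-at allPos p<) ⟩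
  0 ∎) refl)
  where open ≤-Reasoning
strictRemovalBound (suc (suc m)) = strictRemovalBound-step (strictRemovalBound (suc m))

-- Inserting a new value

punchIn : ℕ → ℕ → ℕ
punchIn zero    j       = suc j
punchIn (suc k) zero    = zero
punchIn (suc k) (suc j) = suc (punchIn k j)

punchIn-≢ : ∀ k j → punchIn k j ≢ k
punchIn-≢ (suc k) (suc j) eq = punchIn-≢ k j (suc-injective eq)

punchIn-injective : ∀ k {i j} → punchIn k i ≡ punchIn k j → i ≡ j
punchIn-injective zero    {i}     {j}     eq = suc-injective eq
punchIn-injective (suc k) {zero}  {zero}  eq = refl
punchIn-injective (suc k) {suc i} {suc j} eq = cong suc (punchIn-injective k (suc-injective eq))

punchIn-mono-< : ∀ k {i j} → i < j → punchIn k i < punchIn k j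
punchIn-mono-< zero    i<j       = s<s i<j
punchIn-mono-< (suc k) {zero}  {suc j} _ = z<s
punchIn-mono-< (suc k) {suc i} {suc j} i<j = s<s (punchIn-mono-< k (s<s⁻¹ i<j))

punchIn-cancel-< : ∀ k {i j} → punchIn k i < punchIn k j → i < j
punchIn-cancel-< k {i} {j} lt with <-cmp i j
... | tri< i<j _ _ = i<j
... | tri≈ _ refl _ = ⊥-elim (<-irrefl refl lt)
... | tri> _ _ i>j = ⊥-elim (<-asym lt (punchIn-mono-< k i>j))

punchIn-< : ∀ k {j n} → j < n → punchIn k j < suc n
punchIn-< zero    j<n = s<s j<n
punchIn-< (suc k) {zero}  {suc n} _   = z<s
punchIn-< (suc k) {suc j} {suc n} j<n = s<s (punchIn-< k (s<s⁻¹ j<n))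

<-punchIn⇒≤ : ∀ k j → k < punchIn k j → k ≤ j
<-punchIn⇒≤ zero    j       _  = z≤n
<-punchIn⇒≤ (suc k) (suc j) lt = s≤s (<-punchIn⇒≤ k j (s<s⁻¹ lt))

punchIn-<⇒< : ∀ k j → punchIn k j < k → j < k
punchIn-<⇒< (suc k) zero    _  = z<s
punchIn-<⇒< (suc k) (suc j) lt = s<s (punchIn-<⇒< k j (s<s⁻¹ lt))

punchIn-cover : ∀ k n j′ → k ≤ n → j′ < suc n → j′ ≡ k ⊎ ∃ λ j → j < n × punchIn k j ≡ j′
punchIn-cover zero    n       zero     _   _   = inj₁ refl
punchIn-cover zero    n       (suc j′) _   j′< = inj₂ (j′ , s<s⁻¹ j′< , refl)
punchIn-cover (suc k) (suc n) zero     _   _   = inj₂ (0 , z<s , refl)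
punchIn-cover (suc k) (suc n) (suc j′) k≤n j′< with punchIn-cover k n j′ (s≤s⁻¹ k≤n) (s<s⁻¹ j′<)
... | inj₁ j′≡k          = inj₁ (cong suc j′≡k)
... | inj₂ (j , j< , eq) = inj₂ (suc j , s<s j< , cong suc eq)

length-insertAt : ∀ k x c → length (insertAt k x c) ≡ suc (length c)
length-insertAt zero    x c       = refl
length-insertAt (suc k) x []      = refl
length-insertAt (suc k) x (a ∷ c) = cong suc (length-insertAt k x c)

sum-insertAt : ∀ k x c → sum (insertAt k x c) ≡ x + sum c
sum-insertAt zero    x c       = refl
sum-insertAt (suc k) x []      = refl
sum-insertAt (suc k) x (a ∷ c) = trans (cong (a +_) (sum-insertAt k x c)) (x+[y+z]≡y+[x+z] a x (sum c))

at-insertAt-≡ : ∀ k x c → k ≤ length c → at (insertAt k x c) k ≡ x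
at-insertAt-≡ zero    x c       _   = refl
at-insertAt-≡ (suc k) x (a ∷ c) k≤ = at-insertAt-≡ k x c (s≤s⁻¹ k≤)

at-insertAt-punchIn : ∀ k x c j → k ≤ length c → at (insertAt k x c) (punchIn k j) ≡ at c j
at-insertAt-punchIn zero    x c       j       _  = refl
at-insertAt-punchIn (suc k) x (a ∷ c) zero    _  = refl
at-insertAt-punchIn (suc k) x (a ∷ c) (suc j) k≤ = at-insertAt-punchIn k x c j (s≤s⁻¹ k≤)

removeCard-insertAt-punchIn : ∀ k x c j → k ≤ length c → removeCard (punchIn k j) (insertAt k x c) ≡ insertAt k x (removeCard j c)
removeCard-insertAt-punchIn zero    x c       j       _  = refl
removeCard-insertAt-punchIn (suc k) x (a ∷ c) zero    _  = refl
removeCard-insertAt-punchIn (suc k) x (a ∷ c) (suc j) k≤ = cong (a ∷_) (removeCard-insertAt-punchIn k x c j (s≤s⁻¹ k≤))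

removalSum-insertAt : ∀ κ F k x c → k ≤ length c →
  removalSum κ F (insertAt k x c) ≡ κ k x * F (insertAt k (x ∸ 1) c) + removalSum (κ ∘ punchIn k) (F ∘ insertAt k x) c
removalSum-insertAt κ F zero    x c       _  = refl
removalSum-insertAt κ F (suc k) x (a ∷ c) k≤ =
  trans (cong (H +_) (removalSum-insertAt (κ ∘ suc) (F ∘ (a ∷_)) k x c (s≤s⁻¹ k≤)))
    (x+[y+z]≡y+[x+z] H (κ (suc k) x * F (a ∷ insertAt k (x ∸ 1) c)) _)
  where
  H = κ 0 a * F ((a ∸ 1) ∷ insertAt k x c)

firstMinimum-insertAt-new : ∀ k x c i → k ≤ length c → FirstMinimum c i → x ≤ at c i → x < at c i ⊎ k ≤ i →
  FirstMinimum (insertAt k x c) k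
firstMinimum-insertAt-new k x c i k≤ m x≤ strictOrBefore = record
  { index<   = subst (k <_) (sym (length-insertAt k x c)) (s≤s k≤)
  ; minimal  = λ j′ j′< → subst (_≤ at q j′) (sym (at-insertAt-≡ k x c k≤)) (x≤q j′ (subst (j′ <_) (length-insertAt k x c) j′<))
  ; earliest = λ j′ j′< → subst (_< at q j′) (sym (at-insertAt-≡ k x c k≤)) (x<q j′ j′<)
  }
  where
  open FirstMinimum m
  q = insertAt k x c
  x≤q : ∀ j′ → j′ < suc (length c) → x ≤ at q j′
  x≤q j′ j′< with punchIn-cover k (length c) j′ k≤ j′<
  ... | inj₁ refl = ≤-reflexive (sym (at-insertAt-≡ k x c k≤))
  ... | inj₂ (j , j< , refl) = subst (x ≤_) (sym (at-insertAt-punchIn k x c j k≤)) (≤-trans x≤ (minimal j j<))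
  x<c : ∀ j → j < k → x < at c j
  x<c j j<k = byPosition (<-cmp j i) strictOrBefore
    where
    byPosition : Tri (j < i) (j ≡ i) (j > i) → x < at c i ⊎ k ≤ i → x < at c j
    byPosition (tri< j<i _ _)  _          = ≤-<-trans x≤ (earliest j j<i)
    byPosition _               (inj₁ x<)  = <-≤-trans x< (minimal j (<-≤-trans j<k k≤))
    byPosition (tri≈ _ refl _) (inj₂ k≤i) = ⊥-elim (<-irrefl refl (<-≤-trans j<k k≤i))
    byPosition (tri> _ _ j>i)  (inj₂ k≤i) = ⊥-elim (<-asym j<k (≤-<-trans k≤i j>i))
  x<q : ∀ j′ → j′ < k → x < at q j′
  x<q j′ j′<k with punchIn-cover k (length c) j′ k≤ (≤-trans j′<k (m≤n⇒m≤1+n k≤))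
  ... | inj₁ refl = ⊥-elim (<-irrefl refl j′<k)
  ... | inj₂ (j , j< , refl) = subst (x <_) (sym (at-insertAt-punchIn k x c j k≤)) (x<c j (punchIn-<⇒< k j j′<k))

firstMinimum-insertAt-old : ∀ k x c i → k ≤ length c → FirstMinimum c i → at c i ≤ x → at c i < x ⊎ i < k →
  FirstMinimum (insertAt k x c) (punchIn k i)
firstMinimum-insertAt-old k x c i k≤ m ≤x strictOrBefore = record
  { index<   = subst (punchIn k i <_) (sym (length-insertAt k x c)) (punchIn-< k index<)
  ; minimal  = λ j′ j′< → subst (_≤ at q j′) (sym (at-insertAt-punchIn k x c i k≤)) (cᵢ≤q j′ (subst (j′ <_) (length-insertAt k x c) j′<))
  ; earliest = λ j′ j′< → subst (_< at q j′) (sym (at-insertAt-punchIn k x c i k≤)) (cᵢ<q j′ j′<)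
  }
  where
  open FirstMinimum m
  q = insertAt k x c
  cᵢ≤q : ∀ j′ → j′ < suc (length c) → at c i ≤ at q j′
  cᵢ≤q j′ j′< with punchIn-cover k (length c) j′ k≤ j′<
  ... | inj₁ refl = subst (at c i ≤_) (sym (at-insertAt-≡ k x c k≤)) ≤x
  ... | inj₂ (j , j< , refl) = subst (at c i ≤_) (sym (at-insertAt-punchIn k x c j k≤)) (minimal j j<)
  cᵢ<q : ∀ j′ → j′ < punchIn k i → at c i < at q j′
  cᵢ<q j′ j′< with punchIn-cover k (length c) j′ k≤ (<-trans j′< (punchIn-< k index<))
  ... | inj₂ (j , j< , refl) = subst (at c i <_) (sym (at-insertAt-punchIn k x c j k≤)) (earliest j (punchIn-cancel-< k j′<))
  ... | inj₁ refl = subst (at c i <_) (sym (at-insertAt-≡ k x c k≤)) (cᵢ<x strictOrBefore)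
    where
    cᵢ<x : at c i < x ⊎ i < k → at c i < x
    cᵢ<x (inj₁ cᵢ<x) = cᵢ<x
    cᵢ<x (inj₂ i<k)  = ⊥-elim (<-irrefl refl (<-≤-trans i<k (<-punchIn⇒≤ k i j′<)))

data InsertionGuess (c : List ℕ) (k x : ℕ) : Set where
  guessesNew : x ≤ at c (argmin c) → argmin (insertAt k x c) ≡ k → InsertionGuess c k x
  guessesOld : at c (argmin c) ≤ x → argmin (insertAt k x c) ≡ punchIn k (argmin c) → InsertionGuess c k x

insertionGuess : ∀ c k x → 0 < length c → k ≤ length c → InsertionGuess c k x
insertionGuess c k x 0<len k≤ = decide (<-cmp x (at c i)) (k ≤? i)
  where
  i = argmin c
  m = argmin-firstMinimum c 0<len
  mq = argmin-firstMinimum (insertAt k x c) (subst (0 <_) (sym (length-insertAt k x c)) z<s)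
  newIsFirst : x ≤ at c i → x < at c i ⊎ k ≤ i → argmin (insertAt k x c) ≡ k
  newIsFirst x≤ alt = firstMinimum-unique mq (firstMinimum-insertAt-new k x c i k≤ m x≤ alt)
  oldIsFirst : at c i ≤ x → at c i < x ⊎ i < k → argmin (insertAt k x c) ≡ punchIn k i
  oldIsFirst ≤x alt = firstMinimum-unique mq (firstMinimum-insertAt-old k x c i k≤ m ≤x alt)
  decide : Tri (x < at c i) (x ≡ at c i) (x > at c i) → Dec (k ≤ i) → InsertionGuess c k x
  decide (tri< x< _ _) _         = guessesNew (<⇒≤ x<) (newIsFirst (<⇒≤ x<) (inj₁ x<))
  decide (tri≈ _ x≡ _) (yes k≤i) = guessesNew (≤-reflexive x≡) (newIsFirst (≤-reflexive x≡) (inj₂ k≤i))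
  decide (tri≈ _ x≡ _) (no  k≰i) = guessesOld (≤-reflexive (sym x≡)) (oldIsFirst (≤-reflexive (sym x≡)) (inj₂ (≰⇒> k≰i)))
  decide (tri> _ _ x>) _         = guessesOld (<⇒≤ x>) (oldIsFirst (<⇒≤ x>) (inj₁ x>))

except-punchIn : ∀ k i j a → except (punchIn k i) (punchIn k j) a ≡ except i j a
except-punchIn k i j a with i ≟ j
... | yes refl = trans (except-≡ (punchIn k i) a) (sym (except-≡ i a))
... | no  i≢j  = trans (except-≢ a (i≢j ∘ punchIn-injective k)) (sym (except-≢ a i≢j))

sum-insertAt-pos : ∀ {n} k x c → sum c ≡ suc n → 0 < sum (insertAt k x c)
sum-insertAt-pos {n} k x c sum≡ =
  subst (0 <_) (sym (trans (sum-insertAt k x c) (cong (x +_) sum≡))) (<-≤-trans z<s (m≤n+m (suc n) x))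

wins-insertAt-new : ∀ {n} c k x → sum c ≡ suc n → 0 < length c → k ≤ length c → argmin (insertAt k x c) ≡ k →
  wins (insertAt k x c) ≡
    removalSum (except (argmin c)) (wins ∘ insertAt k x) c + at c (argmin c) * wins (insertAt k x (removeCard (argmin c) c))
wins-insertAt-new c k x sum≡ 0<len k≤ guess≡k = begin
  wins q
    ≡⟨ wins-rec q (sum-insertAt-pos k x c sum≡) ⟩
  removalSum (except (argmin q)) wins q
    ≡⟨ cong (λ j → removalSum (except j) wins q) guess≡k ⟩
  removalSum (except k) wins q
    ≡⟨ removalSum-insertAt (except k) wins k x c k≤ ⟩
  except k k x * wins (insertAt k (x ∸ 1) c) + removalSum (except k ∘ punchIn k) (wins ∘ insertAt k x) c
    ≡⟨ cong₂ _+_ (cong (_* wins (insertAt k (x ∸ 1) c)) (except-≡ k x))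
         (removalSum-cong _ _ _ _ c (λ j _ → cong (_* wins (insertAt k x (removeCard j c))) (except-≢ (at c j) (punchIn-≢ k j ∘ sym)))) ⟩
  removalSum (λ _ → id) (wins ∘ insertAt k x) c
    ≡⟨ removalSum-all (wins ∘ insertAt k x) c (argmin c) (FirstMinimum.index< (argmin-firstMinimum c 0<len)) ⟩
  removalSum (except (argmin c)) (wins ∘ insertAt k x) c + at c (argmin c) * wins (insertAt k x (removeCard (argmin c) c)) ∎
  where
  open ≡-Reasoning
  q = insertAt k x c

wins-insertAt-old : ∀ {n} c k x → sum c ≡ suc n → k ≤ length c → argmin (insertAt k x c) ≡ punchIn k (argmin c) →
  wins (insertAt k x c) ≡ x * wins (insertAt k (x ∸ 1) c) + removalSum (except (argmin c)) (wins ∘ insertAt k x) c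
wins-insertAt-old c k x sum≡ k≤ guess≡ = begin
  wins q
    ≡⟨ wins-rec q (sum-insertAt-pos k x c sum≡) ⟩
  removalSum (except (argmin q)) wins q
    ≡⟨ cong (λ j → removalSum (except j) wins q) guess≡ ⟩
  removalSum (except (punchIn k i)) wins q
    ≡⟨ removalSum-insertAt (except (punchIn k i)) wins k x c k≤ ⟩
  except (punchIn k i) k x * wins (insertAt k (x ∸ 1) c) + removalSum (except (punchIn k i) ∘ punchIn k) (wins ∘ insertAt k x) c
    ≡⟨ cong₂ _+_ (cong (_* wins (insertAt k (x ∸ 1) c)) (except-≢ x (punchIn-≢ k i)))
         (removalSum-cong _ _ _ _ c (λ j _ → cong (_* wins (insertAt k x (removeCard j c))) (except-punchIn k i j (at c j)))) ⟩
  x * wins (insertAt k (x ∸ 1) c) + removalSum (except i) (wins ∘ insertAt k x) c ∎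
  where
  open ≡-Reasoning
  q = insertAt k x c
  i = argmin c

ratio-≤ : ∀ N x a S Y W → W ≡ S + a * Y → W ≤ (N + x) * Y → x ≤ a → (N + x) * S ≤ N * W
ratio-≤ N x a S Y W W≡ W≤ x≤a = +-cancelʳ-≤ (a * W) _ _ (begin
  (N + x) * S + a * W                   ≤⟨ +-monoʳ-≤ ((N + x) * S) (*-monoʳ-≤ a W≤) ⟩
  (N + x) * S + a * ((N + x) * Y)       ≡⟨ cong ((N + x) * S +_) (x*[y*z]≡y*[x*z] a (N + x) Y) ⟩
  (N + x) * S + (N + x) * (a * Y)       ≡⟨ *-distribˡ-+ (N + x) S (a * Y) ⟨
  (N + x) * (S + a * Y)                 ≡⟨ cong ((N + x) *_) W≡ ⟨
  (N + x) * W                           ≡⟨ *-distribʳ-+ W N x ⟩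
  N * W + x * W                         ≤⟨ +-monoʳ-≤ (N * W) (*-monoˡ-≤ W x≤a) ⟩
  N * W + a * W ∎)
  where open ≤-Reasoning

ratio-< : ∀ N x a S Y W → W ≡ S + a * Y → W < (N + x) * Y → x ≤ a → 0 < a → (N + x) * S < N * W
ratio-< N x a S Y W W≡ W< x≤a 0<a = +-cancelʳ-< (a * W) _ _ (begin-strict
  (N + x) * S + a * W                   <⟨ +-monoʳ-< ((N + x) * S) (*-monoʳ-< a {{>-nonZero 0<a}} W<) ⟩
  (N + x) * S + a * ((N + x) * Y)       ≡⟨ cong ((N + x) * S +_) (x*[y*z]≡y*[x*z] a (N + x) Y) ⟩
  (N + x) * S + (N + x) * (a * Y)       ≡⟨ *-distribˡ-+ (N + x) S (a * Y) ⟨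
  (N + x) * (S + a * Y)                 ≡⟨ cong ((N + x) *_) W≡ ⟨
  (N + x) * W                           ≡⟨ *-distribʳ-+ W N x ⟩
  N * W + x * W                         ≤⟨ +-monoʳ-≤ (N * W) (*-monoˡ-≤ W x≤a) ⟩
  N * W + a * W ∎)
  where open ≤-Reasoning

-- g(c) ≤ g(insertAt k x c), denominators cleared.
InsertionBound : List ℕ → ℕ → ℕ → Set
InsertionBound c k x = (sum c + x) ! * wins c ≤ sum c ! * wins (insertAt k x c)

StrictInsertionBound : List ℕ → ℕ → ℕ → Set
StrictInsertionBound c k x = (sum c + x) ! * wins c < sum c ! * wins (insertAt k x c)

wins-insertAt-0 : ∀ c k → k ≤ length c → wins (insertAt k 0 c) ≡ sum c !
wins-insertAt-0 c k k≤ = trans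
  (wins-absent (insertAt k 0 c) k (subst (k <_) (sym (length-insertAt k 0 c)) (s≤s k≤)) (at-insertAt-≡ k 0 c k≤))
  (cong _! (sum-insertAt k 0 c))

insertionBound-0 : ∀ c k → k ≤ length c → InsertionBound c k 0
insertionBound-0 c k k≤ = begin
  (sum c + 0) ! * wins c        ≡⟨ cong (λ m → m ! * wins c) (+-identityʳ (sum c)) ⟩
  sum c ! * wins c              ≤⟨ *-monoʳ-≤ (sum c !) (wins≤! c) ⟩
  sum c ! * sum c !             ≡⟨ cong (sum c ! *_) (wins-insertAt-0 c k k≤) ⟨
  sum c ! * wins (insertAt k 0 c) ∎
  where open ≤-Reasoning

strictInsertionBound-0 : ∀ c k → All (0 <_) c → 0 < length c → k ≤ length c → StrictInsertionBound c k 0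
strictInsertionBound-0 c k allPos 0<len k≤ = begin-strict
  (sum c + 0) ! * wins c        ≡⟨ cong (λ m → m ! * wins c) (+-identityʳ (sum c)) ⟩
  sum c ! * wins c              <⟨ *-monoʳ-< (sum c !) {{sum c !≢0}} (wins<! c allPos 0<len) ⟩
  sum c ! * sum c !             ≡⟨ cong (sum c ! *_) (wins-insertAt-0 c k k≤) ⟨
  sum c ! * wins (insertAt k 0 c) ∎
  where open ≤-Reasoning

insertionBound-empty : ∀ c k x → sum c ≡ 0 → 0 < length c → k ≤ length c → InsertionBound c k x
insertionBound-empty c k x sum≡0 0<len k≤ = ≤-reflexive (begin
  (sum c + x) ! * wins c        ≡⟨ cong₂ (λ m w → (m + x) ! * w) sum≡0 (wins-empty c sum≡0) ⟩
  x ! * 1                       ≡⟨ *-identityʳ (x !) ⟩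
  x !                           ≡⟨ cong _! (trans (sum-insertAt k x c) (trans (cong (x +_) sum≡0) (+-identityʳ x))) ⟨
  sum (insertAt k x c) !        ≡⟨ wins-absent (insertAt k x c) (punchIn k 0)
                                     (subst (punchIn k 0 <_) (sym (length-insertAt k x c)) (punchIn-< k 0<len))
                                     (trans (at-insertAt-punchIn k x c 0 k≤) (n≤0⇒n≡0 (subst (at c 0 ≤_) sum≡0 (at≤sum c 0)))) ⟨
  wins (insertAt k x c)         ≡⟨ *-identityˡ _ ⟨
  1 * wins (insertAt k x c)     ≡⟨ cong (λ m → m ! * wins (insertAt k x c)) sum≡0 ⟨
  sum c ! * wins (insertAt k x c) ∎)
  where open ≡-Reasoning

insertionSum-bound : ∀ {n} c k x → sum c ≡ suc n → (∀ j → 0 < at c j → InsertionBound (removeCard j c) k x) →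
  (n + x) ! * wins c ≤ n ! * removalSum (except (argmin c)) (wins ∘ insertAt k x) c
insertionSum-bound {n} c k x sum≡ ih = begin
  (n + x) ! * wins c                                       ≡⟨ cong ((n + x) ! *_) (wins-rec-suc c sum≡) ⟩
  (n + x) ! * removalSum (except i) wins c                 ≡⟨ removalSum-*ˡ ((n + x) !) (except i) wins c ⟩
  removalSum (except i) (((n + x) ! *_) ∘ wins) c          ≤⟨ removalSum-mono _ _ _ _ c c refl term ⟩
  removalSum (except i) ((n ! *_) ∘ wins ∘ insertAt k x) c ≡⟨ removalSum-*ˡ (n !) (except i) (wins ∘ insertAt k x) c ⟨
  n ! * removalSum (except i) (wins ∘ insertAt k x) c ∎
  where
  open ≤-Reasoning
  i = argmin c
  term : ∀ j → j < length c → except i j (at c j) * ((n + x) ! * wins (removeCard j c))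
                                ≤ except i j (at c j) * (n ! * wins (insertAt k x (removeCard j c)))
  term j _ = guarded-*-mono-≤ ≤-refl (λ 0<κ → let 0<cⱼ = <-≤-trans 0<κ (except-≤ i j (at c j)) in
    subst (λ m → (m + x) ! * wins (removeCard j c) ≤ m ! * wins (insertAt k x (removeCard j c)))
      (sum-removeCard-pred j c sum≡ 0<cⱼ) (ih j 0<cⱼ))

private
  sum-insertAt-comm : ∀ {n} k x c → sum c ≡ suc n → sum (insertAt k x c) ≡ suc n + x
  sum-insertAt-comm {n} k x c sum≡ = trans (sum-insertAt k x c) (trans (cong (x +_) sum≡) (+-comm x (suc n)))

insertionBound-new : ∀ {n} c k x → sum c ≡ suc n → 0 < length c → k ≤ length c → 0 < x → x ≤ at c (argmin c) →
  argmin (insertAt k x c) ≡ k → (∀ j → 0 < at c j → InsertionBound (removeCard j c) k x) → InsertionBound c k x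
insertionBound-new {n} c k x sum≡ 0<len k≤ 0<x x≤ guess≡k ih =
  subst (λ t → (t + x) ! * wins c ≤ t ! * wins q) (sym sum≡) (begin
  (N + x) ! * wins c                   ≡⟨ *-assoc (N + x) ((n + x) !) (wins c) ⟩
  (N + x) * ((n + x) ! * wins c)       ≤⟨ *-monoʳ-≤ (N + x) (insertionSum-bound c k x sum≡ ih) ⟩
  (N + x) * (n ! * S)                  ≡⟨ x*[y*z]≡y*[x*z] (N + x) (n !) S ⟩
  n ! * ((N + x) * S)                  ≤⟨ *-monoʳ-≤ (n !) (ratio-≤ N x (at c i) S Y (wins q) Wq≡ Wq≤ x≤) ⟩
  n ! * (N * wins q)                   ≡⟨ x*[y*z]≡y*[x*z] (n !) N (wins q) ⟩
  N * (n ! * wins q)                   ≡⟨ *-assoc N (n !) (wins q) ⟨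
  N ! * wins q ∎)
  where
  open ≤-Reasoning
  N = suc n
  i = argmin c
  q = insertAt k x c
  S = removalSum (except i) (wins ∘ insertAt k x) c
  Y = wins (insertAt k x (removeCard i c))
  Wq≡ : wins q ≡ S + at c i * Y
  Wq≡ = wins-insertAt-new c k x sum≡ 0<len k≤ guess≡k
  Wq≤ : wins q ≤ (N + x) * Y
  Wq≤ = subst₂ (λ t d → wins q ≤ t * wins d) (sum-insertAt-comm k x c sum≡) (removeCard-insertAt-punchIn k x c i k≤)
    (removalBound (sum q) q (punchIn k i) refl (subst (0 <_) (sym (at-insertAt-punchIn k x c i k≤)) (<-≤-trans 0<x x≤)))

private
  factorial-split : ∀ n x w → (suc n + suc x) ! * w ≡ suc n * ((n + suc x) ! * w) + suc x * ((n + suc x) ! * w)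
  factorial-split n x w = trans (*-assoc (suc n + suc x) ((n + suc x) !) w) (*-distribʳ-+ ((n + suc x) ! * w) (suc n) (suc x))

  wins-insertAt-old-expanded : ∀ {n} c k x → sum c ≡ suc n → k ≤ length c → argmin (insertAt k (suc x) c) ≡ punchIn k (argmin c) →
    suc n ! * wins (insertAt k (suc x) c) ≡
    suc n * (n ! * removalSum (except (argmin c)) (wins ∘ insertAt k (suc x)) c) + suc x * (suc n ! * wins (insertAt k x c))
  wins-insertAt-old-expanded {n} c k x sum≡ k≤ guess≡ =
    trans (cong (suc n ! *_) (wins-insertAt-old c k (suc x) sum≡ k≤ guess≡)) (sym (regroup (suc n) (n !) _ (suc x) _))
    where
    regroup : ∀ t f s y w → t * (f * s) + y * (t * f * w) ≡ t * f * (y * w + s)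
    regroup = solve-∀

  factorial-shift : ∀ {n} c x → sum c ≡ suc n → (sum c + x) ! ≡ (n + suc x) !
  factorial-shift {n} c x sum≡ = cong _! (trans (cong (_+ x) sum≡) (sym (+-suc n x)))

insertionBound-old : ∀ {n} c k x → sum c ≡ suc n → k ≤ length c → argmin (insertAt k (suc x) c) ≡ punchIn k (argmin c) →
  (∀ j → 0 < at c j → InsertionBound (removeCard j c) k (suc x)) → InsertionBound c k x → InsertionBound c k (suc x)
insertionBound-old {n} c k x sum≡ k≤ guess≡ ih ihPred =
  subst (λ t → (t + suc x) ! * wins c ≤ t ! * wins (insertAt k (suc x) c)) (sym sum≡) (begin
  (suc n + suc x) ! * wins c
    ≡⟨ factorial-split n x (wins c) ⟩
  suc n * ((n + suc x) ! * wins c) + suc x * ((n + suc x) ! * wins c)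
    ≤⟨ +-mono-≤ (*-monoʳ-≤ (suc n) (insertionSum-bound c k (suc x) sum≡ ih)) (*-monoʳ-≤ (suc x) ihPred′) ⟩
  suc n * (n ! * _) + suc x * (suc n ! * wins (insertAt k x c))
    ≡⟨ wins-insertAt-old-expanded c k x sum≡ k≤ guess≡ ⟨
  suc n ! * wins (insertAt k (suc x) c) ∎)
  where
  open ≤-Reasoning
  ihPred′ : (n + suc x) ! * wins c ≤ suc n ! * wins (insertAt k x c)
  ihPred′ = subst₂ (λ a b → a * wins c ≤ b * wins (insertAt k x c)) (factorial-shift c x sum≡) (cong _! sum≡) ihPred

insertionBound-step : ∀ c k x → 0 < length c → k ≤ length c →
  (∀ j → 0 < at c j → InsertionBound (removeCard j c) k (suc x)) → InsertionBound c k x → InsertionBound c k (suc x)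
insertionBound-step c k x 0<len k≤ ih ihPred = bySum (sum c) refl
  where
  bySum : ∀ m → sum c ≡ m → InsertionBound c k (suc x)
  bySum zero    sum≡ = insertionBound-empty c k (suc x) sum≡ 0<len k≤
  bySum (suc n) sum≡ with insertionGuess c k (suc x) 0<len k≤
  ... | guessesNew x≤ guess≡ = insertionBound-new c k (suc x) sum≡ 0<len k≤ z<s x≤ guess≡ ih
  ... | guessesOld ≤x guess≡ = insertionBound-old c k x sum≡ k≤ guess≡ ih ihPred

insertionBound : ∀ c k x → 0 < length c → k ≤ length c → InsertionBound c k x
insertionBound c k x = go (suc (sum c + x)) c k x ≤-refl
  where
  go : ∀ N c k x → sum c + x < N → 0 < length c → k ≤ length c → InsertionBound c k x
  go (suc N) c k zero    _   _     k≤ = insertionBound-0 c k k≤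
  go (suc N) c k (suc x) <N 0<len k≤ = insertionBound-step c k x 0<len k≤
    (λ j 0<cⱼ → go N (removeCard j c) k (suc x)
      (s<s⁻¹ (subst (λ m → m + suc x < suc N) (sum-removeCard j c 0<cⱼ) <N))
      (subst (0 <_) (sym (length-removeCard j c)) 0<len) (subst (k ≤_) (sym (length-removeCard j c)) k≤))
    (go N c k x (s<s⁻¹ (subst (_< suc N) (+-suc (sum c) x) <N)) 0<len k≤)

insertionBound-removeCard : ∀ c k x → 0 < length c → k ≤ length c → ∀ j → 0 < at c j → InsertionBound (removeCard j c) k x
insertionBound-removeCard c k x 0<len k≤ j _ =
  insertionBound (removeCard j c) k x (subst (0 <_) (sym (length-removeCard j c)) 0<len) (subst (k ≤_) (sym (length-removeCard j c)) k≤)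

All-insertAt : ∀ {P : ℕ → Set} k x c → All P c → P x → All P (insertAt k x c)
All-insertAt k x c all-c px = All.++⁺ (All.take⁺ k all-c) (px ∷ All.drop⁺ k all-c)

strictInsertionBound-new : ∀ {n} c k x → sum c ≡ suc n → All (0 <_) c → 0 < length c → k ≤ length c → 0 < x →
  x ≤ at c (argmin c) → argmin (insertAt k x c) ≡ k → StrictInsertionBound c k x
strictInsertionBound-new {n} c k x sum≡ allPos 0<len k≤ 0<x x≤ guess≡k =
  subst (λ t → (t + x) ! * wins c < t ! * wins q) (sym sum≡) (begin-strict
  (N + x) ! * wins c                   ≡⟨ *-assoc (N + x) ((n + x) !) (wins c) ⟩
  (N + x) * ((n + x) ! * wins c)       ≤⟨ *-monoʳ-≤ (N + x) (insertionSum-bound c k x sum≡ (insertionBound-removeCard c k x 0<len k≤)) ⟩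
  (N + x) * (n ! * S)                  ≡⟨ x*[y*z]≡y*[x*z] (N + x) (n !) S ⟩
  n ! * ((N + x) * S)                  <⟨ *-monoʳ-< (n !) {{n !≢0}} (ratio-< N x (at c i) S Y (wins q) Wq≡ Wq< x≤ 0<cᵢ) ⟩
  n ! * (N * wins q)                   ≡⟨ x*[y*z]≡y*[x*z] (n !) N (wins q) ⟩
  N * (n ! * wins q)                   ≡⟨ *-assoc N (n !) (wins q) ⟨
  N ! * wins q ∎)
  where
  open ≤-Reasoning
  N = suc n
  i = argmin c
  q = insertAt k x c
  S = removalSum (except i) (wins ∘ insertAt k x) c
  Y = wins (insertAt k x (removeCard i c))
  0<cᵢ = <-≤-trans 0<x x≤
  Wq≡ : wins q ≡ S + at c i * Y
  Wq≡ = wins-insertAt-new c k x sum≡ 0<len k≤ guess≡k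
  Wq< : wins q < (N + x) * Y
  Wq< = subst₂ (λ t d → wins q < t * wins d) (sum-insertAt-comm k x c sum≡) (removeCard-insertAt-punchIn k x c i k≤)
    (strictRemovalBound (sum q) q (punchIn k i) refl (All-insertAt k x c allPos 0<x)
      (subst (2 ≤_) (sym (length-insertAt k x c)) (s≤s 0<len))
      (subst (punchIn k i <_) (sym (length-insertAt k x c)) (punchIn-< k (FirstMinimum.index< (argmin-firstMinimum c 0<len)))))

strictInsertionBound-old : ∀ {n} c k x → sum c ≡ suc n → 0 < length c → k ≤ length c →
  argmin (insertAt k (suc x) c) ≡ punchIn k (argmin c) → StrictInsertionBound c k x → StrictInsertionBound c k (suc x)
strictInsertionBound-old {n} c k x sum≡ 0<len k≤ guess≡ ihPred =
  subst (λ t → (t + suc x) ! * wins c < t ! * wins (insertAt k (suc x) c)) (sym sum≡) (begin-strict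
  (suc n + suc x) ! * wins c
    ≡⟨ factorial-split n x (wins c) ⟩
  suc n * ((n + suc x) ! * wins c) + suc x * ((n + suc x) ! * wins c)
    <⟨ +-mono-≤-< (*-monoʳ-≤ (suc n) (insertionSum-bound c k (suc x) sum≡ (insertionBound-removeCard c k (suc x) 0<len k≤)))
                  (*-monoʳ-< (suc x) ihPred′) ⟩
  suc n * (n ! * _) + suc x * (suc n ! * wins (insertAt k x c))
    ≡⟨ wins-insertAt-old-expanded c k x sum≡ k≤ guess≡ ⟨
  suc n ! * wins (insertAt k (suc x) c) ∎)
  where
  open ≤-Reasoning
  ihPred′ : (n + suc x) ! * wins c < suc n ! * wins (insertAt k x c)
  ihPred′ = subst₂ (λ a b → a * wins c < b * wins (insertAt k x c)) (factorial-shift c x sum≡) (cong _! sum≡) ihPred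

strictInsertionBound : ∀ c k x → All (0 <_) c → 0 < length c → k ≤ length c → StrictInsertionBound c k x
strictInsertionBound c k zero    allPos 0<len k≤ = strictInsertionBound-0 c k allPos 0<len k≤
strictInsertionBound c k (suc x) allPos 0<len k≤ = bySum (sum c) refl
  where
  bySum : ∀ m → sum c ≡ m → StrictInsertionBound c k (suc x)
  bySum zero    sum≡ = ⊥-elim (<⇒≢ (<-≤-trans (All-at allPos 0<len) (at≤sum c 0)) (sym sum≡))
  bySum (suc n) sum≡ with insertionGuess c k (suc x) 0<len k≤
  ... | guessesNew x≤ guess≡ = strictInsertionBound-new c k (suc x) sum≡ allPos 0<len k≤ z<s x≤ guess≡
  ... | guessesOld _  guess≡ = strictInsertionBound-old c k x sum≡ 0<len k≤ guess≡ (strictInsertionBound c k x allPos 0<len k≤)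

cross-≤⇒/≤ : ∀ a A b B .{{_ : NonZero A}} .{{_ : NonZero B}} → B * a ≤ A * b → ℤ.+ a ℚ./ A ℚ.≤ ℤ.+ b ℚ./ B
cross-≤⇒/≤ a A@(suc A-1) b B@(suc B-1) Ba≤Ab = ℚ.toℚᵘ-cancel-≤
  (ℚᵘ.≤-respʳ-≃ (ℚᵘ.≃-sym (ℚ.toℚᵘ-fromℚᵘ (mkℚᵘ (ℤ.+ b) B-1))) (ℚᵘ.≤-respˡ-≃ (ℚᵘ.≃-sym (ℚ.toℚᵘ-fromℚᵘ (mkℚᵘ (ℤ.+ a) A-1)))
    (ℚᵘ.*≤* (subst₂ ℤ._≤_ (ℤ.pos-* a B) (ℤ.pos-* b A) (ℤ.+≤+ (subst₂ _≤_ (*-comm B a) (*-comm A b) Ba≤Ab))))))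

cross-<⇒/< : ∀ a A b B .{{_ : NonZero A}} .{{_ : NonZero B}} → B * a < A * b → ℤ.+ a ℚ./ A ℚ.< ℤ.+ b ℚ./ B
cross-<⇒/< a A@(suc A-1) b B@(suc B-1) Ba<Ab = ℚ.toℚᵘ-cancel-<
  (ℚᵘ.<-respʳ-≃ (ℚᵘ.≃-sym (ℚ.toℚᵘ-fromℚᵘ (mkℚᵘ (ℤ.+ b) B-1))) (ℚᵘ.<-respˡ-≃ (ℚᵘ.≃-sym (ℚ.toℚᵘ-fromℚᵘ (mkℚᵘ (ℤ.+ a) A-1)))
    (ℚᵘ.*<* (subst₂ ℤ._<_ (ℤ.pos-* a B) (ℤ.pos-* b A) (ℤ.+<+ (subst₂ _<_ (*-comm B a) (*-comm A b) Ba<Ab))))))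

proposition2p4 : (s : List ℕ) → 1 ≤ length s → (k x : ℕ) → k ≤ length s →
    (g s ℚ.≤ g (insertAt k x s))
    × (All (λ a → 0 < a) s → g s ℚ.< g (insertAt k x s))
proposition2p4 s 1≤len k x k≤ =
  cross-≤⇒/≤ (wins s) (length (deck s) !) (wins q) (length (deck q) !) {{length (deck s) !≢0}} {{length (deck q) !≢0}}
    (subst₂ (λ m n → m ! * wins s ≤ n ! * wins q) (sym cards-q) (sym (length-deckFrom 0 s)) (insertionBound s k x 1≤len k≤)) ,
  λ allPos → cross-<⇒/< (wins s) (length (deck s) !) (wins q) (length (deck q) !) {{length (deck s) !≢0}} {{length (deck q) !≢0}}
    (subst₂ (λ m n → m ! * wins s < n ! * wins q) (sym cards-q) (sym (length-deckFrom 0 s)) (strictInsertionBound s k x allPos 1≤len k≤))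
  where
  q = insertAt k x s
  cards-q : length (deck q) ≡ sum s + x
  cards-q = trans (length-deckFrom 0 q) (trans (sum-insertAt k x s) (+-comm x (sum s)))
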